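{- Let $n\geq 11$ and let $C\subseteq\mathbb{F}^n$ be a locating-dominating code. Let $\mathbf{u}$ be a special father and $\mathbf{c}\in I(\mathbf{u})$ a special codeword. If $|I_3(\mathbf{u})|\geq n+1$, then after applying Rule 1, $s(\mathbf{c})\leq \frac{n}{2}+1-\frac{1}{n-1}$.
   Context: $\mathbb{F}^n$ is the binary Hamming space: binary words of length $n$ with Hamming distance $d$; words at distance $1$ are adjacent. $N(\mathbf{u})$ is the set of words at distance $1$ from $\mathbf{u}$, $N[\mathbf{u}]=N(\mathbf{u})\cup\{\mathbf{u}\}$, $B_r(\mathbf{u})$ the set of words at distance at most $r$ from $\mathbf{u}$. For a code (nonempty set) $C\subseteq\mathbb{F}^n$, $I(\mathbf{u})=C\cap N[\mathbf{u}]$ and $I_r(\mathbf{u})=C\cap B_r(\mathbf{u})$. $C$ is locating-dominating if $I(\mathbf{u})\neq\emptyset$ for all words and $I(\mathbf{u})\neq I(\mathbf{v})$ for all distinct non-codewords $\mathbf{u},\mathbf{v}$. The (initial) share of $\mathbf{c}\in C$ is $s(\mathbf{c})=\sum_{\mathbf{v}\in N[\mathbf{c}]}1/|I(\mathbf{v})|$. A father is a word $\mathbf{u}$ with $|I(\mathbf{u})|\geq3$. A son is a word $\mathbf{x}$ with $|I(\mathbf{x})|=2$ and $I(\mathbf{x})\subseteq I(\mathbf{u})$ for some father $\mathbf{u}$. An orphan is a non-codeword $\mathbf{x}$ with $|I(\mathbf{x})|=1$. A codeword $\mathbf{c}$ is special if $I(\mathbf{c})=\{\mathbf{c}\}$ and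 $N(\mathbf{c})$ contains exactly one orphan and exactly $n-2$ sons. A special father is a father adjacent to some special codeword. For a special father $\mathbf{u}$, $C'(\mathbf{u})$ is the set of codewords $\mathbf{c}'\in I(\mathbf{u})$ such that $\mathbf{u}$ is the only special father in $N[\mathbf{c}']$ (pairwise disjoint sets). Rule 1: for every special father $\mathbf{u}$, the share of each codeword in $C'(\mathbf{u})$ is replaced by the average $\frac{1}{|C'(\mathbf{u})|}\sum_{\mathbf{a}\in C'(\mathbf{u})}s(\mathbf{a})$; other codewords keep their share. -}

module Defs where

open import Data.Bool using (Bool; true; false; _∧_; _∨_; not; if_then_else_)
open import Data.Nat using (ℕ; zero; suc; _∸_; _≤ᵇ_; _≡ᵇ_)
open import Data.List using (List; []; _∷_; map; _++_; length; filterᵇ; foldr)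
open import Data.Bool.ListAction using (any; all)
open import Data.Vec using (Vec; []; _∷_)
open import Data.Integer using (+_)
open import Data.Rational using (ℚ; 0ℚ; _+_; _*_; _/_)
open import Data.Product using (_×_; ∃)
open import Relation.Binary.PropositionalEquality using (_≡_; _≢_)

Word : ℕ → Set
Word n = Vec Bool n

allWords : (n : ℕ) → List (Word n)
allWords zero = [] ∷ []
allWords (suc n) = map (false ∷_) (allWords n) ++ map (true ∷_) (allWords n)

dist : {n : ℕ} → Word n → Word n → ℕ
dist [] [] = 0
dist (x ∷ xs) (y ∷ ys) = (if (x ∧ not y) ∨ (not x ∧ y) then 1 else 0) Data.Nat.+ dist xs ys

eqW : {n : ℕ} → Word n → Word n → Bool
eqW u v = dist u v ≡ᵇ 0

Code : ℕ → Set
Code n = Word n → Bool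

Nopen : {n : ℕ} → Word n → List (Word n)
Nopen {n} u = filterᵇ (λ v → dist u v ≡ᵇ 1) (allWords n)

Nclosed : {n : ℕ} → Word n → List (Word n)
Nclosed {n} u = filterᵇ (λ v → dist u v ≤ᵇ 1) (allWords n)

Ir : {n : ℕ} → Code n → ℕ → Word n → List (Word n)
Ir {n} C r u = filterᵇ (λ v → C v ∧ (dist u v ≤ᵇ r)) (allWords n)

I : {n : ℕ} → Code n → Word n → List (Word n)
I C u = Ir C 1 u

LocatingDominating : {n : ℕ} → Code n → Set
LocatingDominating {n} C =
  (∃ λ (w : Word n) → C w ≡ true)
  × ((u : Word n) → I C u ≢ [])
  × ((u v : Word n) → C u ≡ false → C v ≡ false → u ≢ v → I C u ≢ I C v)

memW : {n : ℕ} → Word n → List (Word n) → Bool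
memW u xs = any (eqW u) xs

subsetW : {n : ℕ} → List (Word n) → List (Word n) → Bool
subsetW xs ys = all (λ x → memW x ys) xs

-- 1/k as a rational (only used with k ≥ 1)
inv : ℕ → ℚ
inv zero = 0ℚ
inv (suc k) = + 1 / suc k

sumℚ : List ℚ → ℚ
sumℚ = foldr _+_ 0ℚ

share : {n : ℕ} → Code n → Word n → ℚ
share C c = sumℚ (map (λ v → inv (length (I C v))) (Nclosed c))

isFather : {n : ℕ} → Code n → Word n → Bool
isFather C u = 3 ≤ᵇ length (I C u)

isSon : {n : ℕ} → Code n → Word n → Bool
isSon {n} C x = (length (I C x) ≡ᵇ 2)
  ∧ any (λ u → isFather C u ∧ subsetW (I C x) (I C u)) (allWords n)

isOrphan : {n : ℕ} → Code n → Word n → Bool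
isOrphan C x = not (C x) ∧ (length (I C x) ≡ᵇ 1)

countᵇ : {A : Set} → (A → Bool) → List A → ℕ
countᵇ p xs = length (filterᵇ p xs)

isSpecial : {n : ℕ} → Code n → Word n → Bool
isSpecial {n} C c = C c
  ∧ (length (I C c) ≡ᵇ 1) ∧ memW c (I C c)
  ∧ (countᵇ (isOrphan C) (Nopen c) ≡ᵇ 1)
  ∧ (countᵇ (isSon C) (Nopen c) ≡ᵇ (n ∸ 2))

isSpecialFather : {n : ℕ} → Code n → Word n → Bool
isSpecialFather C u = isFather C u ∧ any (isSpecial C) (Nopen u)

onlySF : {n : ℕ} → Code n → Word n → Word n → Bool
onlySF C u c' = all (λ w → not (isSpecialFather C w) ∨ eqW w u) (Nclosed c')
  ∧ memW u (Nclosed c')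

C′ : {n : ℕ} → Code n → Word n → List (Word n)
C′ {n} C u = filterᵇ (λ c' → memW c' (I C u) ∧ onlySF C u c') (allWords n)

average : {n : ℕ} → Code n → List (Word n) → ℚ
average C xs = sumℚ (map (share C) xs) * inv (length xs)

-- share after Rule 1: if a ∈ C'(w) for a special father w (such w is unique,
-- the sets C'(w) being pairwise disjoint), the average over C'(w); otherwise s(a)
rule1Share : {n : ℕ} → Code n → Word n → ℚ
rule1Share {n} C a with filterᵇ (λ w → isSpecialFather C w ∧ memW a (C′ C w)) (allWords n)
... | [] = share C a
... | w ∷ _ = average C (C′ C w)

module Submission where

-- Write c_p = flip p u. As I(c) = {c}, the n - 2 sons of c are its neighbours off u and off the orphan direction io,
-- and their partners c_p (p ≠ io) are codewords; so I(u) = {c_p | p ≠ io} has n - 1 elements and c = c_ic.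
-- The share of c_p collects 1/|I| from c_p, from u (1/(n-1)), from flip io c_p, and from n - 2 neighbours seeing c_p
-- and another c_k (≤ 1/2 each): at most shareCap = n/2 + 1 + 1/(n-1). Reaching n/2 + 1 - 1/(n-1) on average thus
-- needs a total saving of 2 (as |C′(u)| ≤ n - 1).
-- If some c_a ∉ C′(u), a second special father z = flip l c_a is adjacent to c_a; its special neighbour is flip io z
-- and its other neighbours off ic are codewords, so two slots of every further c_p ∈ C′(u) have |I| ≥ 3, saving
-- 1/3 ≥ 2/(n-1), while c and c_j (where d_j = flip io c_j dominates flip io u) together save 1 ≥ 4/(n-1).
-- Otherwise C′(u) = I(u), and |I₃(u)| ≥ n + 1 yields a codeword y ∈ I₃(u) besides I(u) and d_j; by cases on the
-- position of y, c_j and the c_p near y save 2 in total.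

open import Defs
open import Data.Bool using (Bool; true; false; _∧_; _∨_; not; T)
open import Data.Bool.ListAction using (any; all)
open import Data.Bool.Properties using (not-involutive; not-¬) renaming (_≟_ to _≟B_)
open import Data.Nat as ℕ using (ℕ; zero; suc; z≤n; s≤s; _∸_; _≤ᵇ_; _≡ᵇ_)
import Data.Nat.Properties as ℕₚ
open import Data.Fin using (Fin; zero; suc)
open import Data.Fin.Properties using (all?; ¬∀⟶∃¬) renaming (_≟_ to _≟F_)
open import Data.Vec using ([]; _∷_; lookup)
open import Data.Vec.Properties using (∷-injectiveʳ; ≡-dec)
open import Data.List using (List; []; _∷_; map; _++_; length; filterᵇ; filter; allFin)
open import Data.List.Properties using (length-map; length-++; length-tabulate; map-tabulate; map-++; filter-++)
open import Data.List.Membership.Propositional using (_∈_; _∉_)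
open import Data.List.Membership.Propositional.Properties
  using (∈-map⁺; ∈-map⁻; ∈-++⁺ˡ; ∈-++⁺ʳ; ∈-++⁻; ∈-∃++; ∈-filter⁺; ∈-filter⁻; ∈-allFin)
open import Data.List.Relation.Unary.Any using (here; there; any?)
open import Data.List.Relation.Unary.All as All using (All; []; _∷_)
open import Data.List.Relation.Unary.AllPairs using ([]; _∷_)
open import Data.List.Relation.Unary.Unique.Propositional using (Unique)
import Data.List.Relation.Unary.Unique.Propositional.Properties as Unique
open import Data.Integer using (+_)
import Data.Integer as ℤ
import Data.Integer.Properties as ℤₚ
open import Data.Nat.Coprimality using (1-coprimeTo)
import Data.Nat.Coprimality as Coprime
open import Data.Rational using (ℚ; mkℚ; 0ℚ; 1ℚ; ½; _+_; _*_; _-_; -_; _/_; _≤_; *≤*)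
import Data.Rational.Properties as ℚₚ
open import Data.Rational.Solver using (module +-*-Solver)
open import Data.Product using (Σ; _×_; _,_; proj₁; proj₂)
open import Data.Sum using (_⊎_; inj₁; inj₂)
open import Data.Empty using (⊥; ⊥-elim)
open import Data.Unit using (tt)
open import Relation.Nullary using (¬_; Dec; yes; no; ¬?)
open import Relation.Binary.Definitions using (DecidableEquality)
open import Relation.Binary.PropositionalEquality

open +-*-Solver

flip : ∀ {n} → Fin n → Word n → Word n
flip zero (x ∷ w) = not x ∷ w
flip (suc i) (x ∷ w) = x ∷ flip i w

flip-involutive : ∀ {n} (i : Fin n) w → flip i (flip i w) ≡ w
flip-involutive zero (x ∷ w) = cong (_∷ w) (not-involutive x)
flip-involutive (suc i) (x ∷ w) = cong (x ∷_) (flip-involutive i w)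

flip-comm : ∀ {n} (i j : Fin n) w → flip i (flip j w) ≡ flip j (flip i w)
flip-comm zero zero w = refl
flip-comm zero (suc j) (x ∷ w) = refl
flip-comm (suc i) zero (x ∷ w) = refl
flip-comm (suc i) (suc j) (x ∷ w) = cong (x ∷_) (flip-comm i j w)

lookup-flip : ∀ {n} (i : Fin n) w → lookup (flip i w) i ≡ not (lookup w i)
lookup-flip zero (x ∷ w) = refl
lookup-flip (suc i) (x ∷ w) = lookup-flip i w

lookup-flip-≢ : ∀ {n} (i j : Fin n) w → i ≢ j → lookup (flip i w) j ≡ lookup w j
lookup-flip-≢ zero zero w i≢j = ⊥-elim (i≢j refl)
lookup-flip-≢ zero (suc j) (x ∷ w) i≢j = refl
lookup-flip-≢ (suc i) zero (x ∷ w) i≢j = refl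
lookup-flip-≢ (suc i) (suc j) (x ∷ w) i≢j = lookup-flip-≢ i j w (λ e → i≢j (cong suc e))

not-≢-self : ∀ b → not b ≢ b
not-≢-self b e = not-¬ refl (sym e)

flip-≢ : ∀ {n} (i : Fin n) w → flip i w ≢ w
flip-≢ i w e = not-≢-self (lookup w i) (trans (sym (lookup-flip i w)) (cong (λ v → lookup v i) e))

flip-injective : ∀ {n} (i j : Fin n) w → flip i w ≡ flip j w → i ≡ j
flip-injective i j w e with i ≟F j
... | yes i≡j = i≡j
... | no i≢j = ⊥-elim (not-≢-self (lookup w i) (begin
  not (lookup w i)     ≡⟨ sym (lookup-flip i w) ⟩
  lookup (flip i w) i  ≡⟨ cong (λ v → lookup v i) e ⟩
  lookup (flip j w) i  ≡⟨ lookup-flip-≢ j i w (≢-sym i≢j) ⟩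
  lookup w i           ∎))
  where open ≡-Reasoning

flip-flip≡⇒≡ : ∀ {n} (i j : Fin n) w → flip i (flip j w) ≡ w → i ≡ j
flip-flip≡⇒≡ i j w e = sym (flip-injective j i w (trans (sym (flip-involutive i (flip j w))) (cong (flip i) e)))

-- Four flips cancel only in pairs: a flipped position that occurs once changes the word.
flip⁴≡⇒paired : ∀ {n} (a b c d : Fin n) w → flip a (flip b (flip c (flip d w))) ≡ w
              → (a ≡ b × c ≡ d) ⊎ ((a ≡ c × b ≡ d) ⊎ (a ≡ d × b ≡ c))
flip⁴≡⇒paired a b c d w e with a ≟F b
... | yes refl = inj₁ (refl , flip-flip≡⇒≡ c d w (trans (sym (flip-involutive a (flip c (flip d w)))) e))
... | no a≢b with a ≟F c
... | yes refl = inj₂ (inj₁ (refl , flip-flip≡⇒≡ b d w (trans (sym (flip-involutive a (flip b (flip d w))))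
        (trans (cong (flip a) (flip-comm a b (flip d w))) e))))
... | no a≢c with a ≟F d
... | yes refl = inj₂ (inj₂ (refl , flip-flip≡⇒≡ b c w (trans (sym (flip-involutive a (flip b (flip c w))))
        (trans (cong (flip a) (trans (flip-comm a b (flip c w)) (cong (flip b) (flip-comm a c w)))) e))))
... | no a≢d = ⊥-elim (not-≢-self (lookup w a) (sym (trans (cong (λ v → lookup v a) (sym e))
       (trans (lookup-flip a _) (cong not (trans (lookup-flip-≢ b a _ (≢-sym a≢b))
         (trans (lookup-flip-≢ c a _ (≢-sym a≢c)) (lookup-flip-≢ d a w (≢-sym a≢d)))))))))

dist-refl : ∀ {n} (w : Word n) → dist w w ≡ 0
dist-refl [] = refl
dist-refl (true ∷ w) = dist-refl w
dist-refl (false ∷ w) = dist-refl w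

dist≡0⇒≡ : ∀ {n} (u v : Word n) → dist u v ≡ 0 → u ≡ v
dist≡0⇒≡ [] [] e = refl
dist≡0⇒≡ (true ∷ u) (true ∷ v) e = cong (true ∷_) (dist≡0⇒≡ u v e)
dist≡0⇒≡ (false ∷ u) (false ∷ v) e = cong (false ∷_) (dist≡0⇒≡ u v e)
dist≡0⇒≡ (true ∷ u) (false ∷ v) ()
dist≡0⇒≡ (false ∷ u) (true ∷ v) ()

dist-flip : ∀ {n} (i : Fin n) (w : Word n) → dist w (flip i w) ≡ 1
dist-flip zero (true ∷ w) = cong suc (dist-refl w)
dist-flip zero (false ∷ w) = cong suc (dist-refl w)
dist-flip (suc i) (true ∷ w) = dist-flip i w
dist-flip (suc i) (false ∷ w) = dist-flip i w

dist-suc⇒flip : ∀ {n} (u v : Word n) k → dist u v ≡ suc k → Σ (Fin n) λ i → dist (flip i u) v ≡ k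
dist-suc⇒flip [] [] k ()
dist-suc⇒flip (true ∷ u) (false ∷ v) k e = zero , ℕₚ.suc-injective e
dist-suc⇒flip (false ∷ u) (true ∷ v) k e = zero , ℕₚ.suc-injective e
dist-suc⇒flip (true ∷ u) (true ∷ v) k e with dist-suc⇒flip u v k e
... | i , p = suc i , p
dist-suc⇒flip (false ∷ u) (false ∷ v) k e with dist-suc⇒flip u v k e
... | i , p = suc i , p

dist≡1⇒flip : ∀ {n} (u v : Word n) → dist u v ≡ 1 → Σ (Fin n) λ i → v ≡ flip i u
dist≡1⇒flip u v e with dist-suc⇒flip u v 0 e
... | i , p = i , sym (dist≡0⇒≡ (flip i u) v p)

dist≤1⇒≡⊎flip : ∀ {n} (u v : Word n) → (dist u v ≤ᵇ 1) ≡ true → (v ≡ u) ⊎ (Σ (Fin n) λ i → v ≡ flip i u)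
dist≤1⇒≡⊎flip u v e with dist u v in eq
... | zero = inj₁ (sym (dist≡0⇒≡ u v eq))
... | suc zero = inj₂ (dist≡1⇒flip u v eq)
... | suc (suc _) with () ← e

dist≤ᵇ1-refl : ∀ {n} (u : Word n) → (dist u u ≤ᵇ 1) ≡ true
dist≤ᵇ1-refl u rewrite dist-refl u = refl

dist≤ᵇ1-flip : ∀ {n} (i : Fin n) (u : Word n) → (dist u (flip i u) ≤ᵇ 1) ≡ true
dist≤ᵇ1-flip i u rewrite dist-flip i u = refl

eqW⇒≡ : ∀ {n} (u v : Word n) → eqW u v ≡ true → u ≡ v
eqW⇒≡ u v e with dist u v in eq
... | zero = dist≡0⇒≡ u v eq
... | suc _ with () ← e

eqW-refl : ∀ {n} (u : Word n) → eqW u u ≡ true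
eqW-refl u rewrite dist-refl u = refl

eqW-≢ : ∀ {n} (u v : Word n) → u ≢ v → eqW u v ≡ false
eqW-≢ u v u≢v with eqW u v in eq
... | true = ⊥-elim (u≢v (eqW⇒≡ u v eq))
... | false = refl

_≟W_ : ∀ {n} → DecidableEquality (Word n)
_≟W_ = ≡-dec _≟B_

true≢false : ∀ {b} → b ≡ true → b ≡ false → ⊥
true≢false refl ()

¬true⇒false : ∀ {b} → ¬ (b ≡ true) → b ≡ false
¬true⇒false {true} h = ⊥-elim (h refl)
¬true⇒false {false} h = refl

∧-true⁻ : ∀ {a b} → a ∧ b ≡ true → a ≡ true × b ≡ true
∧-true⁻ {true} {true} e = refl , refl

∧-true⁺ : ∀ {a b} → a ≡ true → b ≡ true → a ∧ b ≡ true
∧-true⁺ refl refl = refl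

∧-false⁻ : ∀ a {b} → a ∧ b ≡ false → a ≡ false ⊎ b ≡ false
∧-false⁻ false e = inj₁ refl
∧-false⁻ true e = inj₂ e

∨-true⁻ : ∀ {a b} → a ∨ b ≡ true → a ≡ true ⊎ b ≡ true
∨-true⁻ {true} e = inj₁ refl
∨-true⁻ {false} e = inj₂ e

∨-false⁻ : ∀ {a b} → a ∨ b ≡ false → a ≡ false × b ≡ false
∨-false⁻ {false} {false} e = refl , refl

not-false⁻ : ∀ {a} → not a ≡ false → a ≡ true
not-false⁻ {true} e = refl

≡true⇒T : ∀ {b} → b ≡ true → T b
≡true⇒T refl = tt

≡ᵇ-true⇒≡ : ∀ {a b} → (a ≡ᵇ b) ≡ true → a ≡ b
≡ᵇ-true⇒≡ {a} {b} e = ℕₚ.≡ᵇ⇒≡ a b (≡true⇒T e)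

module _ {A : Set} (p : A → Bool) where

  ∈-filterᵇ⁻ : ∀ {x} xs → x ∈ filterᵇ p xs → x ∈ xs × p x ≡ true
  ∈-filterᵇ⁻ (y ∷ xs) x∈ with p y in eq
  ∈-filterᵇ⁻ (y ∷ xs) (here refl) | true = here refl , eq
  ∈-filterᵇ⁻ (y ∷ xs) (there x∈) | true = let (a , b) = ∈-filterᵇ⁻ xs x∈ in there a , b
  ∈-filterᵇ⁻ (y ∷ xs) x∈ | false = let (a , b) = ∈-filterᵇ⁻ xs x∈ in there a , b

  ∈-filterᵇ⁺ : ∀ {x} xs → x ∈ xs → p x ≡ true → x ∈ filterᵇ p xs
  ∈-filterᵇ⁺ (y ∷ xs) (here refl) px with p y
  ... | true = here refl
  ... | false with () ← px
  ∈-filterᵇ⁺ (y ∷ xs) (there x∈) px with p y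
  ... | true = there (∈-filterᵇ⁺ xs x∈ px)
  ... | false = ∈-filterᵇ⁺ xs x∈ px

  filterᵇ-unique : ∀ {xs} → Unique xs → Unique (filterᵇ p xs)
  filterᵇ-unique = Unique.filter⁺ _

  any⇒∃ : ∀ xs → any p xs ≡ true → Σ A λ x → x ∈ xs × p x ≡ true
  any⇒∃ (x ∷ xs) e with p x in eq
  ... | true = x , here refl , eq
  ... | false = let (y , y∈ , py) = any⇒∃ xs e in y , there y∈ , py

  ∈⇒any : ∀ {x} xs → x ∈ xs → p x ≡ true → any p xs ≡ true
  ∈⇒any (y ∷ xs) (here refl) px rewrite px = refl
  ∈⇒any (y ∷ xs) (there x∈) px with p y
  ... | true = refl
  ... | false = ∈⇒any xs x∈ px

  all⇒∀∈ : ∀ xs → all p xs ≡ true → ∀ {x} → x ∈ xs → p x ≡ true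
  all⇒∀∈ (y ∷ xs) e (here refl) with p y
  ... | true = refl
  ... | false with () ← e
  all⇒∀∈ (y ∷ xs) e (there x∈) with p y
  ... | true = all⇒∀∈ xs e x∈
  ... | false with () ← e

  all-false⇒∃ : ∀ xs → all p xs ≡ false → Σ A λ x → x ∈ xs × p x ≡ false
  all-false⇒∃ (x ∷ xs) e with p x in eq
  ... | false = x , here refl , eq
  ... | true = let (y , y∈ , py) = all-false⇒∃ xs e in y , there y∈ , py

  countᵇ≡1⇒∃ : ∀ xs → countᵇ p xs ≡ 1 → Σ A λ x → x ∈ xs × p x ≡ true
  countᵇ≡1⇒∃ xs e with filterᵇ p xs in eq
  ... | y ∷ _ = y , ∈-filterᵇ⁻ xs (subst (y ∈_) (sym eq) (here refl))

countᵇ-partition : ∀ {A : Set} (p q : A → Bool) xs → (∀ x → p x ≡ true → q x ≡ true → ⊥) →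
  countᵇ p xs ℕ.+ countᵇ q xs ℕ.+ countᵇ (λ x → not (p x ∨ q x)) xs ≡ length xs
countᵇ-partition p q [] disjoint = refl
countᵇ-partition p q (x ∷ xs) disjoint with p x in ep | q x in eq
... | true | true = ⊥-elim (disjoint x ep eq)
... | true | false = cong suc (countᵇ-partition p q xs disjoint)
... | false | true = trans (cong (ℕ._+ countᵇ (λ x → not (p x ∨ q x)) xs) (ℕₚ.+-suc (countᵇ p xs) (countᵇ q xs)))
                           (cong suc (countᵇ-partition p q xs disjoint))
... | false | false = trans (ℕₚ.+-suc (countᵇ p xs ℕ.+ countᵇ q xs) _) (cong suc (countᵇ-partition p q xs disjoint))

memW⇒∈ : ∀ {n} (u : Word n) xs → memW u xs ≡ true → u ∈ xs
memW⇒∈ u xs e with any⇒∃ (eqW u) xs e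
... | y , y∈ , uy with eqW⇒≡ u y uy
... | refl = y∈

∈⇒memW : ∀ {n} (u : Word n) xs → u ∈ xs → memW u xs ≡ true
∈⇒memW u xs u∈ = ∈⇒any (eqW u) xs u∈ (eqW-refl u)

∈-allWords : ∀ {n} (w : Word n) → w ∈ allWords n
∈-allWords [] = here refl
∈-allWords {suc n} (false ∷ w) = ∈-++⁺ˡ (∈-map⁺ (false ∷_) (∈-allWords w))
∈-allWords {suc n} (true ∷ w) = ∈-++⁺ʳ (map (false ∷_) (allWords n)) (∈-map⁺ (true ∷_) (∈-allWords w))

allWords-unique : ∀ n → Unique (allWords n)
allWords-unique zero = [] ∷ []
allWords-unique (suc n) =
  Unique.++⁺ (Unique.map⁺ ∷-injectiveʳ (allWords-unique n)) (Unique.map⁺ ∷-injectiveʳ (allWords-unique n)) disjoint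
  where
    disjoint : ∀ {v} → v ∈ map (false ∷_) (allWords n) × v ∈ map (true ∷_) (allWords n) → ⊥
    disjoint (v∈f , v∈t) with ∈-map⁻ (false ∷_) v∈f | ∈-map⁻ (true ∷_) v∈t
    ... | _ , _ , refl | _ , _ , ()

module _ {A : Set} (_≟_ : DecidableEquality A) where

  All≢⇒∉ : ∀ {x : A} {xs} → All (x ≢_) xs → ∀ {y} → y ∈ xs → x ≢ y
  All≢⇒∉ (px ∷ _) (here refl) = px
  All≢⇒∉ (_ ∷ pxs) (there y∈) = All≢⇒∉ pxs y∈

  ⊆⇒length≤ : ∀ (xs ys : List A) → Unique xs → (∀ {x} → x ∈ xs → x ∈ ys) → length xs ℕ.≤ length ys
  ⊆⇒length≤ [] ys _ _ = z≤n
  ⊆⇒length≤ (x ∷ xs) ys (x∉xs ∷ unique) xs⊆ys with ∈-∃++ (xs⊆ys (here refl))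
  ... | as , bs , refl = subst (suc (length xs) ℕ.≤_) (sym length-split) (s≤s (⊆⇒length≤ xs (as ++ bs) unique xs⊆as++bs))
    where
      length-split : length (as ++ x ∷ bs) ≡ suc (length (as ++ bs))
      length-split = trans (length-++ as) (trans (ℕₚ.+-suc (length as) (length bs)) (cong suc (sym (length-++ as))))
      xs⊆as++bs : ∀ {y} → y ∈ xs → y ∈ as ++ bs
      xs⊆as++bs y∈ with ∈-++⁻ as (xs⊆ys (there y∈))
      ... | inj₁ a = ∈-++⁺ˡ a
      ... | inj₂ (here refl) = ⊥-elim (All≢⇒∉ x∉xs y∈ refl)
      ... | inj₂ (there b) = ∈-++⁺ʳ as b

  ⊈⇒∃∉ : ∀ (xs ys : List A) → ¬ (∀ {x} → x ∈ xs → x ∈ ys) → Σ A λ x → x ∈ xs × x ∉ ys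
  ⊈⇒∃∉ [] ys xs⊈ys = ⊥-elim (xs⊈ys (λ ()))
  ⊈⇒∃∉ (x ∷ xs) ys xs⊈ys with any? (x ≟_) ys
  ... | no x∉ = x , here refl , x∉
  ... | yes x∈ with ⊈⇒∃∉ xs ys (λ f → xs⊈ys (λ { (here refl) → x∈ ; (there m) → f m }))
  ... | z , z∈ , z∉ = z , there z∈ , z∉

  remove : A → List A → List A
  remove a = filter (λ x → ¬? (x ≟ a))

  remove-unique : ∀ a {xs} → Unique xs → Unique (remove a xs)
  remove-unique a = Unique.filter⁺ _

  ∈-remove⁺ : ∀ {a x} xs → x ∈ xs → x ≢ a → x ∈ remove a xs
  ∈-remove⁺ xs = ∈-filter⁺ (λ x → ¬? (x ≟ _))

  ∈-remove⁻ : ∀ {a x} xs → x ∈ remove a xs → x ∈ xs × x ≢ a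
  ∈-remove⁻ xs = ∈-filter⁻ (λ x → ¬? (x ≟ _))

  remove-∉ : ∀ a xs → All (a ≢_) xs → remove a xs ≡ xs
  remove-∉ a [] _ = refl
  remove-∉ a (x ∷ xs) (a≢x ∷ a∉xs) with x ≟ a
  ... | yes refl = ⊥-elim (a≢x refl)
  ... | no _ = cong (x ∷_) (remove-∉ a xs a∉xs)

  length-remove : ∀ a xs → Unique xs → a ∈ xs → length xs ≡ suc (length (remove a xs))
  length-remove a (x ∷ xs) (x∉xs ∷ _) (here refl) with x ≟ x
  ... | yes _ = cong (λ z → suc (length z)) (sym (remove-∉ x xs x∉xs))
  ... | no x≢x = ⊥-elim (x≢x refl)
  length-remove a (x ∷ xs) (x∉xs ∷ unique) (there a∈) with x ≟ a
  ... | yes refl = ⊥-elim (All≢⇒∉ x∉xs a∈ refl)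
  ... | no _ = cong suc (length-remove a xs unique a∈)

length≤countᵇ : ∀ {n} (p : Word n → Bool) (S xs : List (Word n)) → Unique S → (∀ {x} → x ∈ S → x ∈ xs × p x ≡ true) →
  length S ℕ.≤ countᵇ p xs
length≤countᵇ p S xs unique h = ⊆⇒length≤ _≟W_ S (filterᵇ p xs) unique (λ x∈ → let (a , b) = h x∈ in ∈-filterᵇ⁺ p xs a b)

length≡1⇒≡ : ∀ {A : Set} (xs : List A) {s y} → length xs ≡ 1 → s ∈ xs → y ∈ xs → y ≡ s
length≡1⇒≡ (a ∷ []) e (here refl) (here refl) = refl

length≡2⇒other : ∀ {A : Set} (xs : List A) {s} → Unique xs → length xs ≡ 2 → s ∈ xs → Σ A λ y → y ∈ xs × y ≢ s
length≡2⇒other (a ∷ b ∷ []) ((a≢b ∷ []) ∷ _) e (here refl) = b , there (here refl) , ≢-sym a≢b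
length≡2⇒other (a ∷ b ∷ []) ((a≢b ∷ []) ∷ _) e (there (here refl)) = a , here refl , a≢b

times : ℕ → ℚ → ℚ
times zero c = 0ℚ
times (suc k) c = c + times k c

fromℕ : ℕ → ℚ
fromℕ k = mkℚ (+ k) 0 (Coprime.sym (1-coprimeTo k))

inv≡mkℚ : ∀ k → inv (suc k) ≡ mkℚ (+ 1) k (1-coprimeTo (suc k))
inv≡mkℚ k = ℚₚ.normalize-coprime (1-coprimeTo (suc k))

inv-antimono : ∀ {a b} → a ℕ.≤ b → inv (suc b) ≤ inv (suc a)
inv-antimono {a} {b} a≤b rewrite inv≡mkℚ a | inv≡mkℚ b =
  *≤* (subst₂ ℤ._≤_ (sym (ℤₚ.*-identityˡ (+ suc a))) (sym (ℤₚ.*-identityˡ (+ suc b))) (ℤ.+≤+ (s≤s a≤b)))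

inv≤1 : ∀ k → inv k ≤ 1ℚ
inv≤1 zero = ℚₚ.≤ᵇ⇒≤ _
inv≤1 (suc k) = inv-antimono {0} {k} z≤n

inv≤inv-suc : ∀ {k x} → suc k ℕ.≤ x → inv x ≤ inv (suc k)
inv≤inv-suc {k} {suc x} (s≤s k≤x) = inv-antimono k≤x

times-1ℚ : ∀ k → times k 1ℚ ≡ fromℕ k
times-1ℚ zero = refl
times-1ℚ (suc k) rewrite times-1ℚ k =
  trans (cong (_/ 1) (cong (λ z → + 1 ℤ.+ z) (ℤₚ.*-identityʳ (+ k)))) (ℚₚ.normalize-coprime (Coprime.sym (1-coprimeTo (suc k))))

times≡times1* : ∀ k c → times k c ≡ times k 1ℚ * c
times≡times1* zero c = sym (ℚₚ.*-zeroˡ c)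
times≡times1* (suc k) c rewrite times≡times1* k c =
  solve 2 (λ c r → c :+ r :* c := (con 1ℚ :+ r) :* c) refl c (times k 1ℚ)

times-*-inv : ∀ k c → times (suc k) c * inv (suc k) ≡ c
times-*-inv k c rewrite times≡times1* (suc k) c | times-1ℚ (suc k) | inv≡mkℚ k = begin
  fromℕ (suc k) * c * i      ≡⟨ solve 3 (λ a b c → (a :* c) :* b := (a :* b) :* c) refl (fromℕ (suc k)) i c ⟩
  fromℕ (suc k) * i * c      ≡⟨ cong (_* c) (ℚₚ.*-inverseʳ (fromℕ (suc k))) ⟩
  1ℚ * c                     ≡⟨ ℚₚ.*-identityˡ c ⟩
  c                          ∎
  where
    open ≡-Reasoning
    i : ℚ
    i = mkℚ (+ 1) k (1-coprimeTo (suc k))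

times-+ : ∀ a b c → times (a ℕ.+ b) c ≡ times a c + times b c
times-+ zero b c = sym (ℚₚ.+-identityˡ _)
times-+ (suc a) b c rewrite times-+ a b c = sym (ℚₚ.+-assoc c (times a c) (times b c))

+n/2≡times½ : ∀ n → + n / 2 ≡ times n ½
+n/2≡times½ n = sym (trans (times≡times1* n ½) (trans (cong (_* ½) (times-1ℚ n)) (cong (_/ 2) (ℤₚ.*-identityʳ (+ n)))))

sumMap : ∀ {A : Set} → (A → ℚ) → List A → ℚ
sumMap f xs = sumℚ (map f xs)

sumMap-mono : ∀ {A : Set} (f g : A → ℚ) xs → (∀ {x} → x ∈ xs → f x ≤ g x) → sumMap f xs ≤ sumMap g xs
sumMap-mono f g [] h = ℚₚ.≤-refl
sumMap-mono f g (x ∷ xs) h = ℚₚ.+-mono-≤ (h (here refl)) (sumMap-mono f g xs (λ x∈ → h (there x∈)))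

sumMap-const : ∀ {A : Set} (c : ℚ) (xs : List A) → sumMap (λ _ → c) xs ≡ times (length xs) c
sumMap-const c [] = refl
sumMap-const c (x ∷ xs) = cong (_+_ c) (sumMap-const c xs)

sumℚ-++ : ∀ (xs ys : List ℚ) → sumℚ (xs ++ ys) ≡ sumℚ xs + sumℚ ys
sumℚ-++ [] ys = sym (ℚₚ.+-identityˡ _)
sumℚ-++ (x ∷ xs) ys rewrite sumℚ-++ xs ys = sym (ℚₚ.+-assoc x (sumℚ xs) (sumℚ ys))

sumℚ-map-map : ∀ {A B : Set} (f : B → ℚ) (g : A → B) xs → sumℚ (map f (map g xs)) ≡ sumMap (λ x → f (g x)) xs
sumℚ-map-map f g [] = refl
sumℚ-map-map f g (x ∷ xs) = cong (_+_ (f (g x))) (sumℚ-map-map f g xs)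

sumMap-remove : ∀ {A : Set} (_≟_ : DecidableEquality A) (f : A → ℚ) a xs → Unique xs → a ∈ xs →
  sumMap f xs ≡ f a + sumMap f (remove _≟_ a xs)
sumMap-remove _≟_ f a (x ∷ xs) (x∉xs ∷ _) (here refl) with x ≟ x
... | yes _ = cong (λ z → f x + sumMap f z) (sym (remove-∉ _≟_ x xs x∉xs))
... | no x≢x = ⊥-elim (x≢x refl)
sumMap-remove _≟_ f a (x ∷ xs) (x∉xs ∷ unique) (there a∈) with x ≟ a
... | yes refl = ⊥-elim (All≢⇒∉ _≟_ x∉xs a∈ refl)
... | no _ rewrite sumMap-remove _≟_ f a xs unique a∈ =
  solve 3 (λ p q r → p :+ (q :+ r) := q :+ (p :+ r)) refl (f x) (f a) (sumMap f (remove _≟_ a xs))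

sumMap≤sub+rest : ∀ {A : Set} (_≟_ : DecidableEquality A) (g : A → ℚ) (h : ℚ) (E L : List A) → Unique L → Unique E →
  (∀ {e} → e ∈ E → e ∈ L) → (∀ {k} → k ∈ L → k ∉ E → g k ≤ h) →
  sumMap g L ≤ sumMap g E + times (length L ∸ length E) h
sumMap≤sub+rest _≟_ g h [] L _ _ _ bound =
  subst (sumMap g L ≤_) (sym (ℚₚ.+-identityˡ _))
    (subst (sumMap g L ≤_) (sumMap-const h L) (sumMap-mono g (λ _ → h) L (λ k∈ → bound k∈ (λ ()))))
sumMap≤sub+rest {A} _≟_ g h (e ∷ E) L uL (e∉E ∷ uE) E⊆L bound =
  subst (_≤ sumMap g (e ∷ E) + times (length L ∸ length (e ∷ E)) h) (sym (sumMap-remove _≟_ g e L uL e∈L))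
  (subst (λ z → g e + sumMap g L′ ≤ g e + sumMap g E + times (z ∸ suc (length E)) h) (sym (length-remove _≟_ e L uL e∈L))
    (subst (g e + sumMap g L′ ≤_) (sym (ℚₚ.+-assoc (g e) (sumMap g E) _))
      (ℚₚ.+-monoʳ-≤ (g e) (sumMap≤sub+rest _≟_ g h E L′ (remove-unique _≟_ e uL) uE
        (λ k∈ → ∈-remove⁺ _≟_ L (E⊆L (there k∈)) (λ q → All≢⇒∉ _≟_ e∉E k∈ (sym q)))
        (λ {k} k∈ k∉ → let (k∈L , k≢e) = ∈-remove⁻ _≟_ L k∈ in bound k∈L (λ { (here q) → k≢e q ; (there q) → k∉ q }))))))
  where
    e∈L : e ∈ L
    e∈L = E⊆L (here refl)
    L′ : List A
    L′ = remove _≟_ e L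

sumFin : ∀ n → (Fin n → ℚ) → ℚ
sumFin n g = sumMap g (allFin n)

sumFin-suc : ∀ n (g : Fin (suc n) → ℚ) → sumFin (suc n) g ≡ g zero + sumFin n (λ k → g (suc k))
sumFin-suc n g = cong (λ z → g zero + sumℚ z) (trans (map-tabulate suc g) (sym (map-tabulate (λ x → x) (λ k → g (suc k)))))

filterᵇ-map : ∀ {A B : Set} (p : B → Bool) (g : A → B) xs → filterᵇ p (map g xs) ≡ map g (filterᵇ (λ x → p (g x)) xs)
filterᵇ-map p g [] = refl
filterᵇ-map p g (x ∷ xs) with p (g x)
... | true = cong (g x ∷_) (filterᵇ-map p g xs)
... | false = filterᵇ-map p g xs

filterᵇ-cong : ∀ {A : Set} (p q : A → Bool) xs → (∀ x → p x ≡ q x) → filterᵇ p xs ≡ filterᵇ q xs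
filterᵇ-cong p q [] h = refl
filterᵇ-cong p q (x ∷ xs) h with p x | q x | h x
... | true | true | _ = cong (x ∷_) (filterᵇ-cong p q xs h)
... | false | false | _ = filterᵇ-cong p q xs h

filterᵇ-false : ∀ {A : Set} (xs : List A) → filterᵇ (λ _ → false) xs ≡ []
filterᵇ-false [] = refl
filterᵇ-false (x ∷ xs) = filterᵇ-false xs

sumMap-filterᵇ-allWords-suc : ∀ {n} (P : Word (suc n) → Bool) (f : Word (suc n) → ℚ) →
  sumMap f (filterᵇ P (allWords (suc n))) ≡
  sumMap (λ v → f (false ∷ v)) (filterᵇ (λ v → P (false ∷ v)) (allWords n)) +
  sumMap (λ v → f (true ∷ v)) (filterᵇ (λ v → P (true ∷ v)) (allWords n))
sumMap-filterᵇ-allWords-suc {n} P f = begin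
    sumℚ (map f (filterᵇ P (map (false ∷_) A ++ map (true ∷_) A)))
      ≡⟨ cong (λ z → sumℚ (map f z)) (filter-++ _ (map (false ∷_) A) (map (true ∷_) A)) ⟩
    sumℚ (map f (filterᵇ P (map (false ∷_) A) ++ filterᵇ P (map (true ∷_) A)))
      ≡⟨ cong sumℚ (map-++ f (filterᵇ P (map (false ∷_) A)) _) ⟩
    sumℚ (map f (filterᵇ P (map (false ∷_) A)) ++ map f (filterᵇ P (map (true ∷_) A)))
      ≡⟨ sumℚ-++ (map f (filterᵇ P (map (false ∷_) A))) _ ⟩
    sumℚ (map f (filterᵇ P (map (false ∷_) A))) + sumℚ (map f (filterᵇ P (map (true ∷_) A)))
      ≡⟨ cong₂ _+_ (half false) (half true) ⟩
    _ ∎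
  where
    open ≡-Reasoning
    A : List (Word n)
    A = allWords n
    half : ∀ b → sumℚ (map f (filterᵇ P (map (b ∷_) A))) ≡ sumMap (λ v → f (b ∷ v)) (filterᵇ (λ v → P (b ∷ v)) A)
    half b = trans (cong (λ z → sumℚ (map f z)) (filterᵇ-map P (b ∷_) A)) (sumℚ-map-map f (b ∷_) (filterᵇ (λ v → P (b ∷ v)) A))

sumMap-filterᵇ-dist≡0 : ∀ {n} (c : Word n) (f : Word n → ℚ) → sumMap f (filterᵇ (λ v → dist c v ≡ᵇ 0) (allWords n)) ≡ f c + 0ℚ
sumMap-filterᵇ-dist≡0 {zero} [] f = refl
sumMap-filterᵇ-dist≡0 {suc n} (false ∷ c) f rewrite sumMap-filterᵇ-allWords-suc (λ v → dist (false ∷ c) v ≡ᵇ 0) f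
  | sumMap-filterᵇ-dist≡0 c (λ v → f (false ∷ v)) | filterᵇ-false (allWords n) = ℚₚ.+-identityʳ _
sumMap-filterᵇ-dist≡0 {suc n} (true ∷ c) f rewrite sumMap-filterᵇ-allWords-suc (λ v → dist (true ∷ c) v ≡ᵇ 0) f
  | sumMap-filterᵇ-dist≡0 c (λ v → f (true ∷ v)) | filterᵇ-false (allWords n) = ℚₚ.+-identityˡ _

suc≤ᵇ1≡≡ᵇ0 : ∀ d → (suc d ≤ᵇ 1) ≡ (d ≡ᵇ 0)
suc≤ᵇ1≡≡ᵇ0 zero = refl
suc≤ᵇ1≡≡ᵇ0 (suc d) = refl

sumMap-Nclosed : ∀ {n} (c : Word n) (f : Word n → ℚ) → sumMap f (Nclosed c) ≡ f c + sumFin n (λ k → f (flip k c))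
sumMap-Nclosed {zero} [] f = refl
sumMap-Nclosed {suc n} (false ∷ c) f
  rewrite sumMap-filterᵇ-allWords-suc (λ v → dist (false ∷ c) v ≤ᵇ 1) f
  | filterᵇ-cong (λ v → suc (dist c v) ≤ᵇ 1) (λ v → dist c v ≡ᵇ 0) (allWords n) (λ v → suc≤ᵇ1≡≡ᵇ0 (dist c v))
  | sumMap-filterᵇ-dist≡0 c (λ v → f (true ∷ v)) | sumMap-Nclosed c (λ v → f (false ∷ v))
  | sumFin-suc n (λ k → f (flip k (false ∷ c)))
  = solve 3 (λ a b s → (a :+ s) :+ (b :+ con 0ℚ) := a :+ (b :+ s)) refl (f (false ∷ c)) (f (true ∷ c)) _
sumMap-Nclosed {suc n} (true ∷ c) f
  rewrite sumMap-filterᵇ-allWords-suc (λ v → dist (true ∷ c) v ≤ᵇ 1) f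
  | filterᵇ-cong (λ v → suc (dist c v) ≤ᵇ 1) (λ v → dist c v ≡ᵇ 0) (allWords n) (λ v → suc≤ᵇ1≡≡ᵇ0 (dist c v))
  | sumMap-filterᵇ-dist≡0 c (λ v → f (false ∷ v)) | sumMap-Nclosed c (λ v → f (true ∷ v))
  | sumFin-suc n (λ k → f (flip k (true ∷ c)))
  = solve 3 (λ a b s → (b :+ con 0ℚ) :+ (a :+ s) := a :+ (b :+ s)) refl (f (true ∷ c)) (f (false ∷ c)) _

flip∈Nopen : ∀ {n} k (s : Word n) → flip k s ∈ Nopen s
flip∈Nopen {n} k s = ∈-filterᵇ⁺ _ (allWords n) (∈-allWords (flip k s)) (cong (_≡ᵇ 1) (dist-flip k s))

∈Nopen⇒flip : ∀ {n} {s x : Word n} → x ∈ Nopen s → Σ (Fin n) λ k → x ≡ flip k s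
∈Nopen⇒flip {n} {s} {x} x∈ = dist≡1⇒flip s x (≡ᵇ-true⇒≡ (proj₂ (∈-filterᵇ⁻ _ (allWords n) x∈)))

length-Nopen≤ : ∀ {n} (s : Word n) → length (Nopen s) ℕ.≤ n
length-Nopen≤ {n} s =
  subst (length (Nopen s) ℕ.≤_) (trans (length-map (λ k → flip k s) (allFin n)) (length-tabulate (λ x → x)))
    (⊆⇒length≤ _≟W_ (Nopen s) (map (λ k → flip k s) (allFin n)) (filterᵇ-unique _ (allWords-unique n))
      (λ x∈ → let (k , e) = ∈Nopen⇒flip {s = s} x∈ in
        subst (_∈ map (λ k → flip k s) (allFin n)) (sym e) (∈-map⁺ (λ k → flip k s) (∈-allFin k))))

flip∈Nclosed : ∀ {n} l (x : Word n) → flip l x ∈ Nclosed x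
flip∈Nclosed {n} l x = ∈-filterᵇ⁺ _ (allWords n) (∈-allWords (flip l x)) (dist≤ᵇ1-flip l x)

∈Nclosed⇒≡⊎flip : ∀ {n} {x z : Word n} → z ∈ Nclosed x → (z ≡ x) ⊎ Σ (Fin n) λ l → z ≡ flip l x
∈Nclosed⇒≡⊎flip {n} {x} {z} z∈ = dist≤1⇒≡⊎flip x z (proj₂ (∈-filterᵇ⁻ _ (allWords n) z∈))

flip≢-of-dist≥2 : ∀ {n} {u y : Word n} {k} i → dist u y ≡ suc (suc k) → y ≢ flip i u
flip≢-of-dist≥2 {u = u} i eq refl with () ← trans (sym (dist-flip i u)) eq

data Within3 {n} (u y : Word n) : Set where
  at0 : y ≡ u → Within3 u y
  at1 : ∀ a → y ≡ flip a u → Within3 u y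
  at2 : ∀ a b → a ≢ b → y ≡ flip a (flip b u) → Within3 u y
  at3 : ∀ a b p → a ≢ b → a ≢ p → b ≢ p → y ≡ flip a (flip b (flip p u)) → Within3 u y

within3 : ∀ {n} (u y : Word n) → (dist u y ≤ᵇ 3) ≡ true → Within3 u y
within3 u y le with dist u y in eq
... | 0 = at0 (sym (dist≡0⇒≡ u y eq))
... | 1 = let (a , e) = dist≡1⇒flip u y eq in at1 a e
... | 2 with dist-suc⇒flip u y 1 eq
... | i , e₁ with dist≡1⇒flip (flip i u) y e₁
... | a , e₂ with a ≟F i
... | yes refl with () ← trans (sym (trans (cong (dist u) (trans e₂ (flip-involutive a u))) (dist-refl u))) eq
... | no a≢i = at2 a i a≢i e₂
within3 u y le | 3 with dist-suc⇒flip u y 2 eq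
... | i₁ , e₁ with dist-suc⇒flip (flip i₁ u) y 1 e₁
... | i₂ , e₂ with dist≡1⇒flip (flip i₂ (flip i₁ u)) y e₂
... | i₃ , e₃ with i₂ ≟F i₁ | i₃ ≟F i₂ | i₃ ≟F i₁
... | yes refl | _ | _ = ⊥-elim (flip≢-of-dist≥2 i₃ eq (trans e₃ (cong (flip i₃) (flip-involutive i₂ u))))
... | no _ | yes refl | _ = ⊥-elim (flip≢-of-dist≥2 i₁ eq (trans e₃ (flip-involutive i₃ (flip i₁ u))))
... | no _ | no _ | yes refl =
  ⊥-elim (flip≢-of-dist≥2 i₂ eq (trans e₃ (trans (cong (flip i₃) (flip-comm i₂ i₃ u)) (flip-involutive i₃ (flip i₂ u)))))
... | no i₂≢i₁ | no i₃≢i₂ | no i₃≢i₁ = at3 i₃ i₂ i₁ i₃≢i₂ i₃≢i₁ i₂≢i₁ e₃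
within3 u y le | suc (suc (suc (suc _))) with () ← le

module CodeFacts {n} (C : Code n) where

  ∣I∣ : Word n → ℕ
  ∣I∣ x = length (I C x)

  I-unique : ∀ x → Unique (I C x)
  I-unique x = filterᵇ-unique _ (allWords-unique n)

  ∈I⁻ : ∀ {x y} → y ∈ I C x → C y ≡ true × (dist x y ≤ᵇ 1) ≡ true
  ∈I⁻ {x} y∈ = ∧-true⁻ (proj₂ (∈-filterᵇ⁻ _ (allWords n) y∈))

  ∈I⁺ : ∀ {x y} → C y ≡ true → (dist x y ≤ᵇ 1) ≡ true → y ∈ I C x
  ∈I⁺ {x} {y} y∈C d = ∈-filterᵇ⁺ _ (allWords n) (∈-allWords y) (∧-true⁺ y∈C d)

  ∈I-self : ∀ x → C x ≡ true → x ∈ I C x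
  ∈I-self x x∈C = ∈I⁺ {x} x∈C (dist≤ᵇ1-refl x)

  ∈I-flip : ∀ k x y → y ≡ flip k x → C y ≡ true → y ∈ I C x
  ∈I-flip k x y refl y∈C = ∈I⁺ {x} y∈C (dist≤ᵇ1-flip k x)

  ∈I⇒≡⊎flip : ∀ {x y} → y ∈ I C x → C y ≡ true × ((y ≡ x) ⊎ (Σ (Fin n) λ i → y ≡ flip i x))
  ∈I⇒≡⊎flip {x} {y} y∈ = let (y∈C , d) = ∈I⁻ {x} y∈ in y∈C , dist≤1⇒≡⊎flip x y d

  ⊆I⇒length≤ : ∀ x (S : List (Word n)) → Unique S → (∀ {y} → y ∈ S → y ∈ I C x) → length S ℕ.≤ ∣I∣ x
  ⊆I⇒length≤ x S = ⊆⇒length≤ _≟W_ S (I C x)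

  2≤∣I∣ : ∀ x a b → a ≢ b → a ∈ I C x → b ∈ I C x → 2 ℕ.≤ ∣I∣ x
  2≤∣I∣ x a b a≢b a∈ b∈ = ⊆I⇒length≤ x (a ∷ b ∷ []) ((a≢b ∷ []) ∷ [] ∷ []) λ where
    (here refl) → a∈
    (there (here refl)) → b∈

  3≤∣I∣ : ∀ x a b c → a ≢ b → a ≢ c → b ≢ c → a ∈ I C x → b ∈ I C x → c ∈ I C x → 3 ℕ.≤ ∣I∣ x
  3≤∣I∣ x a b c a≢b a≢c b≢c a∈ b∈ c∈ = ⊆I⇒length≤ x (a ∷ b ∷ c ∷ []) ((a≢b ∷ a≢c ∷ []) ∷ (b≢c ∷ []) ∷ [] ∷ []) λ where
    (here refl) → a∈
    (there (here refl)) → b∈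
    (there (there (here refl))) → c∈

  ∈I⇒∈Nclosed : ∀ {x y} → y ∈ I C x → x ∈ Nclosed y
  ∈I⇒∈Nclosed {x} y∈ with ∈I⇒≡⊎flip {x} y∈
  ... | _ , inj₁ refl = ∈-filterᵇ⁺ _ (allWords n) (∈-allWords x) (dist≤ᵇ1-refl x)
  ... | _ , inj₂ (k , refl) = subst (_∈ Nclosed (flip k x)) (flip-involutive k x) (flip∈Nclosed k (flip k x))

  father⇒3≤∣I∣ : ∀ {x} → isFather C x ≡ true → 3 ℕ.≤ ∣I∣ x
  father⇒3≤∣I∣ {x} e = ℕₚ.≤ᵇ⇒≤ 3 (∣I∣ x) (≡true⇒T e)

  ∣I∣≤2⇒¬father : ∀ x → ∣I∣ x ℕ.≤ 2 → isFather C x ≡ true → ⊥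
  ∣I∣≤2⇒¬father x ≤2 x-father = ℕₚ.≤⇒≯ (father⇒3≤∣I∣ {x} x-father) (s≤s ≤2)

  son⇒∣I∣≡2 : ∀ {x} → isSon C x ≡ true → ∣I∣ x ≡ 2
  son⇒∣I∣≡2 {x} e = ≡ᵇ-true⇒≡ (proj₁ (∧-true⁻ {∣I∣ x ≡ᵇ 2} e))

  orphan⇒∣I∣≡1 : ∀ {x} → isOrphan C x ≡ true → ∣I∣ x ≡ 1
  orphan⇒∣I∣≡1 {x} e = ≡ᵇ-true⇒≡ (proj₂ (∧-true⁻ {not (C x)} e))

  special⇒∣I∣≡1 : ∀ {s} → isSpecial C s ≡ true → ∣I∣ s ≡ 1
  special⇒∣I∣≡1 {s} e = ≡ᵇ-true⇒≡ (proj₁ (∧-true⁻ {∣I∣ s ≡ᵇ 1} (proj₂ (∧-true⁻ {C s} e))))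

  special⇒∈C : ∀ {s} → isSpecial C s ≡ true → C s ≡ true
  special⇒∈C e = proj₁ (∧-true⁻ e)

  special⇒flip∉C : ∀ {s} → isSpecial C s ≡ true → ∀ k → C (flip k s) ≡ false
  special⇒flip∉C {s} e k = ¬true⇒false λ flip∈C →
    flip-≢ k s (length≡1⇒≡ (I C s) (special⇒∣I∣≡1 e) (∈I-self s (special⇒∈C e)) (∈I-flip k s (flip k s) refl flip∈C))

  ∣I∣≥3⇒¬son∨orphan : ∀ x → 3 ℕ.≤ ∣I∣ x → not (isSon C x ∨ isOrphan C x) ≡ true
  ∣I∣≥3⇒¬son∨orphan x ∣I∣≥3 with isSon C x in son | isOrphan C x in orphan
  ... | true | _ = ⊥-elim (ℕₚ.≤⇒≯ ∣I∣≥3 (subst (ℕ._< 3) (sym (son⇒∣I∣≡2 {x} son)) (s≤s (s≤s (s≤s z≤n)))))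
  ... | false | true = ⊥-elim (ℕₚ.≤⇒≯ ∣I∣≥3 (subst (ℕ._< 3) (sym (orphan⇒∣I∣≡1 {x} orphan)) (s≤s (s≤s z≤n))))
  ... | false | false = refl

module SpecialCodeword {n} (n≥2 : 2 ℕ.≤ n) (C : Code n) (s : Word n) (m : Fin n)
                       (special : isSpecial C s ≡ true) (father : isFather C (flip m s) ≡ true) where

  open CodeFacts C

  private
    conditions : (countᵇ (isOrphan C) (Nopen s) ≡ᵇ 1) ≡ true × (countᵇ (isSon C) (Nopen s) ≡ᵇ (n ∸ 2)) ≡ true
    conditions = ∧-true⁻ (proj₂ (∧-true⁻ {memW s (I C s)} (proj₂ (∧-true⁻ {∣I∣ s ≡ᵇ 1} (proj₂ (∧-true⁻ {C s} special))))))

    orphan-count : countᵇ (isOrphan C) (Nopen s) ≡ 1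
    orphan-count = ≡ᵇ-true⇒≡ (proj₁ conditions)

    son-count : countᵇ (isSon C) (Nopen s) ≡ n ∸ 2
    son-count = ≡ᵇ-true⇒≡ (proj₂ conditions)

  s∈C : C s ≡ true
  s∈C = special⇒∈C special

  ∣I-s∣≡1 : ∣I∣ s ≡ 1
  ∣I-s∣≡1 = special⇒∣I∣≡1 special

  flip∉C : ∀ k → C (flip k s) ≡ false
  flip∉C = special⇒flip∉C special

  -- Besides the father, N(s) holds n - 2 sons and one orphan, so there is no room for anything else.
  son⊎orphan : ∀ k → k ≢ m → (isSon C (flip k s) ∨ isOrphan C (flip k s)) ≡ true
  son⊎orphan k k≢m with isSon C (flip k s) ∨ isOrphan C (flip k s) in e
  ... | true = refl
  ... | false = ⊥-elim (ℕₚ.≤⇒≯ total (subst (n ℕ.<_) (sym n∸2+1+2≡suc-n) (ℕₚ.n<1+n n)))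
    where
      disjoint : ∀ x → isSon C x ≡ true → isOrphan C x ≡ true → ⊥
      disjoint x son orphan with () ← trans (sym (son⇒∣I∣≡2 {x} son)) (orphan⇒∣I∣≡1 {x} orphan)
      neither≥2 : 2 ℕ.≤ countᵇ (λ x → not (isSon C x ∨ isOrphan C x)) (Nopen s)
      neither≥2 = length≤countᵇ _ (flip k s ∷ flip m s ∷ []) (Nopen s)
        (((λ q → k≢m (flip-injective k m s q)) ∷ []) ∷ [] ∷ [])
        (λ { (here refl) → flip∈Nopen k s , cong not e
           ; (there (here refl)) → flip∈Nopen m s , ∣I∣≥3⇒¬son∨orphan (flip m s) (father⇒3≤∣I∣ {flip m s} father) })
      total : n ∸ 2 ℕ.+ 1 ℕ.+ 2 ℕ.≤ n
      total = subst (ℕ._≤ n) (cong₂ (λ a b → a ℕ.+ b ℕ.+ _) son-count orphan-count)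
        (ℕₚ.≤-trans (ℕₚ.+-monoʳ-≤ (countᵇ (isSon C) (Nopen s) ℕ.+ countᵇ (isOrphan C) (Nopen s)) neither≥2)
          (subst (ℕ._≤ n) (sym (countᵇ-partition (isSon C) (isOrphan C) (Nopen s) disjoint)) (length-Nopen≤ s)))
      n∸2+1+2≡suc-n : n ∸ 2 ℕ.+ 1 ℕ.+ 2 ≡ suc n
      n∸2+1+2≡suc-n = trans (ℕₚ.+-assoc (n ∸ 2) 1 2) (trans (ℕₚ.+-comm (n ∸ 2) 3) (cong suc (ℕₚ.m+[n∸m]≡n n≥2)))

  ∣I-flip∣≤2 : ∀ k → k ≢ m → ∣I∣ (flip k s) ℕ.≤ 2
  ∣I-flip∣≤2 k k≢m with ∨-true⁻ (son⊎orphan k k≢m)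
  ... | inj₁ son = ℕₚ.≤-reflexive (son⇒∣I∣≡2 {flip k s} son)
  ... | inj₂ orphan = ℕₚ.≤-trans (ℕₚ.≤-reflexive (orphan⇒∣I∣≡1 {flip k s} orphan)) (s≤s z≤n)

  private
    orphan-witness : Σ (Word n) λ x → x ∈ Nopen s × isOrphan C x ≡ true
    orphan-witness = countᵇ≡1⇒∃ (isOrphan C) (Nopen s) orphan-count
    orphan-flip : Σ (Fin n) λ k → proj₁ orphan-witness ≡ flip k s
    orphan-flip = ∈Nopen⇒flip {s = s} (proj₁ (proj₂ orphan-witness))

  orphan : Fin n
  orphan = proj₁ orphan-flip

  flip-orphan-isOrphan : isOrphan C (flip orphan s) ≡ true
  flip-orphan-isOrphan = subst (λ x → isOrphan C x ≡ true) (proj₂ orphan-flip) (proj₂ (proj₂ orphan-witness))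

  ∣I-flip-orphan∣≡1 : ∣I∣ (flip orphan s) ≡ 1
  ∣I-flip-orphan∣≡1 = orphan⇒∣I∣≡1 {flip orphan s} flip-orphan-isOrphan

  orphan≢m : orphan ≢ m
  orphan≢m e = ℕₚ.≤⇒≯ (father⇒3≤∣I∣ {flip m s} father)
    (subst (ℕ._< 3) (sym (subst (λ z → ∣I∣ (flip z s) ≡ 1) e ∣I-flip-orphan∣≡1)) (s≤s (s≤s z≤n)))

  father-flip-orphan∉C : C (flip orphan (flip m s)) ≡ false
  father-flip-orphan∉C = ¬true⇒false λ c → ℕₚ.<⇒≱ (s≤s (s≤s z≤n)) (subst (2 ℕ.≤_) ∣I-flip-orphan∣≡1
    (2≤∣I∣ (flip orphan s) s (flip orphan (flip m s)) (λ q → orphan≢m (flip-flip≡⇒≡ orphan m s (sym q)))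
      (∈I-flip orphan (flip orphan s) s (sym (flip-involutive orphan s)) s∈C)
      (∈I-flip m (flip orphan s) (flip orphan (flip m s)) (flip-comm orphan m s) c)))

  neighbour-son : ∀ k → k ≢ m → k ≢ orphan → isSon C (flip k s) ≡ true
  neighbour-son k k≢m k≢orphan with ∨-true⁻ (son⊎orphan k k≢m)
  ... | inj₁ son = son
  ... | inj₂ isOrphan-k = ⊥-elim (ℕₚ.<⇒≱ (s≤s (s≤s z≤n)) (subst (2 ℕ.≤_) orphan-count
         (length≤countᵇ (isOrphan C) (flip k s ∷ flip orphan s ∷ []) (Nopen s)
           (((λ q → k≢orphan (flip-injective k orphan s q)) ∷ []) ∷ [] ∷ [])
           (λ { (here refl) → flip∈Nopen k s , isOrphan-k ; (there (here refl)) → flip∈Nopen orphan s , flip-orphan-isOrphan }))))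

  -- A father whose I contains s is adjacent to s, and the only neighbour of s with |I| ≥ 3 is flip m s.
  father∋s⇒≡ : ∀ {f} → 3 ℕ.≤ ∣I∣ f → s ∈ I C f → f ≡ flip m s
  father∋s⇒≡ {f} ∣I∣≥3 s∈ with proj₂ (∈I⇒≡⊎flip {f} s∈)
  ... | inj₁ s≡f = ⊥-elim (ℕₚ.≤⇒≯ ∣I∣≥3 (subst (λ z → ∣I∣ z ℕ.< 3) s≡f
          (subst (ℕ._< 3) (sym ∣I-s∣≡1) (s≤s (s≤s z≤n)))))
  ... | inj₂ (l , s≡) with l ≟F m
  ... | yes refl = trans (sym (flip-involutive l f)) (cong (flip l) (sym s≡))
  ... | no l≢m = ⊥-elim (ℕₚ.≤⇒≯ ∣I∣≥3 (subst (λ z → ∣I∣ z ℕ.< 3) (trans (cong (flip l) s≡) (flip-involutive l f))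
          (s≤s (∣I-flip∣≤2 l l≢m))))

  son-partner : ∀ k → k ≢ m → k ≢ orphan → Σ (Word n) λ y → y ∈ I C (flip k s) × y ∈ I C (flip m s) × y ≢ s
  son-partner k k≢m k≢orphan =
    let (y , y∈ , y≢s) = length≡2⇒other (I C x) (I-unique x) ∣I-x∣≡2 s∈I-x in y , y∈ , I-x⊆I-v y∈ , y≢s
    where
      x : Word n
      x = flip k s
      son : (∣I∣ x ≡ᵇ 2) ≡ true × any (λ f → isFather C f ∧ subsetW (I C x) (I C f)) (allWords n) ≡ true
      son = ∧-true⁻ {∣I∣ x ≡ᵇ 2} (neighbour-son k k≢m k≢orphan)
      ∣I-x∣≡2 : ∣I∣ x ≡ 2
      ∣I-x∣≡2 = ≡ᵇ-true⇒≡ (proj₁ son)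
      father-of-x : Σ (Word n) λ f → f ∈ allWords n × (isFather C f ∧ subsetW (I C x) (I C f)) ≡ true
      father-of-x = any⇒∃ (λ f → isFather C f ∧ subsetW (I C x) (I C f)) (allWords n) (proj₂ son)
      f : Word n
      f = proj₁ father-of-x
      father∧subset : isFather C f ≡ true × subsetW (I C x) (I C f) ≡ true
      father∧subset = ∧-true⁻ {isFather C f} (proj₂ (proj₂ father-of-x))
      I-x⊆I-f : ∀ {y} → y ∈ I C x → y ∈ I C f
      I-x⊆I-f {y} y∈ = memW⇒∈ y (I C f) (all⇒∀∈ (λ y → memW y (I C f)) (I C x) (proj₂ father∧subset) y∈)
      s∈I-x : s ∈ I C x
      s∈I-x = ∈I-flip k x s (sym (flip-involutive k s)) s∈C
      I-x⊆I-v : ∀ {y} → y ∈ I C x → y ∈ I C (flip m s)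
      I-x⊆I-v y∈ = subst (λ z → _ ∈ I C z) (father∋s⇒≡ {f} (father⇒3≤∣I∣ {f} (proj₁ father∧subset)) (I-x⊆I-f s∈I-x)) (I-x⊆I-f y∈)

  -- The partner y is one flip away from both flip k s and flip m s; as y ≢ s, this forces y = flip k (flip m s).
  father-flip∈C : ∀ k → k ≢ m → k ≢ orphan → C (flip k (flip m s)) ≡ true
  father-flip∈C k k≢m k≢orphan with son-partner k k≢m k≢orphan
  ... | y , y∈I-x , y∈I-v , y≢s with ∈I⇒≡⊎flip {flip k s} y∈I-x | ∈I⇒≡⊎flip {flip m s} y∈I-v
  ... | y∈C , inj₁ refl | _ = ⊥-elim (true≢false y∈C (flip∉C k))
  ... | y∈C , inj₂ _ | _ , inj₁ refl = ⊥-elim (true≢false y∈C (flip∉C m))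
  ... | y∈C , inj₂ (a , refl) | _ , inj₂ (b , y≡)
    with flip⁴≡⇒paired m b a k s (trans (cong (λ z → flip m (flip b z)) y≡)
                                 (trans (cong (flip m) (flip-involutive b (flip m s))) (flip-involutive m s)))
  ... | inj₁ (refl , refl) = ⊥-elim (y≢s (flip-involutive a s))
  ... | inj₂ (inj₁ (refl , refl)) = subst (λ z → C z ≡ true) y≡ y∈C
  ... | inj₂ (inj₂ (refl , refl)) = ⊥-elim (k≢m refl)

⅓ : ℚ
⅓ = inv 3

1/[n-1] : ℕ → ℚ
1/[n-1] n = inv (suc (n ∸ 2))

bound : ℕ → ℚ
bound n = ((+ n / 2) + 1ℚ) - inv (n ∸ 1)

-- The share of a codeword flip p u ∈ I(u): 1/|I| of the word itself (≤ α), of the neighbour in the orphan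
-- direction (≤ β), of u (= 1/(n-1)), of e further neighbours (≤ 1/3), and of the remaining n - 2 - e (≤ 1/2).
shareBound : ℕ → ℚ → ℚ → ℕ → ℚ
shareBound n α β e = α + ((1/[n-1] n + (β + times e ⅓)) + times (n ∸ suc (suc e)) ½)

shareCap : ℕ → ℚ
shareCap n = shareBound n 1ℚ 1ℚ 0

saving : ℚ → ℚ → ℕ → ℚ
saving α β e = (1ℚ - α) + ((1ℚ - β) + times e (½ - ⅓))

shareBound≡shareCap-saving : ∀ {n} e → suc (suc e) ℕ.≤ n → ∀ α β → shareBound n α β e ≡ shareCap n - saving α β e
shareBound≡shareCap-saving {suc (suc m)} e (s≤s (s≤s e≤m)) α β = begin
    α + ((ε + (β + times e ⅓)) + K)
      ≡⟨ cong (λ z → α + ((ε + (β + z)) + K)) (times≡times1* e ⅓) ⟩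
    α + ((ε + (β + t * ⅓)) + K)
      ≡⟨ solve 5 (λ a b i t K → a :+ ((i :+ (b :+ t :* con ⅓)) :+ K) :=
                   (con 1ℚ :+ ((i :+ (con 1ℚ :+ con 0ℚ)) :+ (t :* con ½ :+ K))) :-
                   ((con 1ℚ :- a) :+ ((con 1ℚ :- b) :+ t :* (con ½ :- con ⅓))))
                 refl α β ε t K ⟩
    (1ℚ + ((ε + (1ℚ + 0ℚ)) + (t * ½ + K))) - ((1ℚ - α) + ((1ℚ - β) + t * (½ - ⅓)))
      ≡⟨ cong₂ (λ x y → (1ℚ + ((ε + (1ℚ + 0ℚ)) + x)) - ((1ℚ - α) + ((1ℚ - β) + y))) (sym split) (sym (times≡times1* e (½ - ⅓))) ⟩
    shareCap (suc (suc m)) - saving α β e ∎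
  where
    open ≡-Reasoning
    ε : ℚ
    ε = 1/[n-1] (suc (suc m))
    t : ℚ
    t = times e 1ℚ
    K : ℚ
    K = times (m ∸ e) ½
    split : times m ½ ≡ t * ½ + K
    split = trans (cong (λ z → times z ½) (sym (ℕₚ.m+[n∸m]≡n e≤m))) (trans (times-+ e (m ∸ e) ½) (cong (_+ K) (times≡times1* e ½)))

≤-by-difference : ∀ x y d → 0ℚ ≤ d → y ≡ x + d → x ≤ y
≤-by-difference x y d 0≤d e = subst (_≤ y) (ℚₚ.+-identityʳ x) (subst (x + 0ℚ ≤_) (sym e) (ℚₚ.+-monoʳ-≤ x 0≤d))

p≤q⇒0≤q-p : ∀ {p q} → p ≤ q → 0ℚ ≤ q - p
p≤q⇒0≤q-p {p} {q} p≤q = subst (_≤ q - p) (ℚₚ.+-inverseʳ p) (ℚₚ.+-monoˡ-≤ (- p) p≤q)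

0≤+0≤ : ∀ {a b} → 0ℚ ≤ a → 0ℚ ≤ b → 0ℚ ≤ a + b
0≤+0≤ {a} {b} 0≤a 0≤b = subst (_≤ a + b) (ℚₚ.+-identityʳ 0ℚ) (ℚₚ.+-mono-≤ 0≤a 0≤b)

1/[n-1]≤1/10 : ∀ {n} → 11 ℕ.≤ n → 1/[n-1] n ≤ inv 10
1/[n-1]≤1/10 {suc (suc n)} (s≤s (s≤s 9≤n)) = inv-antimono {9} {n} 9≤n

caseI-other≤bound : ∀ {n} → 11 ℕ.≤ n → shareBound n 1ℚ 1ℚ 2 ≤ bound n
caseI-other≤bound {n@(suc (suc (suc (suc r))))} n≥11@(s≤s (s≤s (s≤s (s≤s _)))) rewrite +n/2≡times½ n =
  ≤-by-difference _ _ ((⅓ - (inv 10 + inv 10)) + ((inv 10 - ε) + (inv 10 - ε)))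
    (0≤+0≤ {⅓ - (inv 10 + inv 10)} (ℚₚ.≤ᵇ⇒≤ _) (0≤+0≤ {inv 10 - ε} {inv 10 - ε} ε≤ ε≤))
    (solve 3 (λ i t K → ((con ½ :+ (con ½ :+ (con ½ :+ (con ½ :+ K)))) :+ con 1ℚ) :- i :=
        (con 1ℚ :+ ((i :+ (con 1ℚ :+ (con ⅓ :+ (con ⅓ :+ con 0ℚ)))) :+ K)) :+ ((con ⅓ :- (t :+ t)) :+ ((t :- i) :+ (t :- i))))
      refl ε (inv 10) (times r ½))
  where
    ε : ℚ
    ε = 1/[n-1] n
    ε≤ : 0ℚ ≤ inv 10 - ε
    ε≤ = p≤q⇒0≤q-p (1/[n-1]≤1/10 n≥11)

caseI-pair≤bound : ∀ {n} → 11 ℕ.≤ n → shareBound n 1ℚ 1ℚ 0 + shareBound n ½ ½ 0 ≤ bound n + bound n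
caseI-pair≤bound {n@(suc (suc r))} n≥11@(s≤s (s≤s _)) rewrite +n/2≡times½ n =
  ≤-by-difference _ _ ((1ℚ - (inv 10 + inv 10 + inv 10 + inv 10)) + ((inv 10 - ε) + (inv 10 - ε) + (inv 10 - ε) + (inv 10 - ε)))
    (0≤+0≤ {1ℚ - (inv 10 + inv 10 + inv 10 + inv 10)} (ℚₚ.≤ᵇ⇒≤ _)
      (0≤+0≤ {(inv 10 - ε) + (inv 10 - ε) + (inv 10 - ε)} {inv 10 - ε}
        (0≤+0≤ {(inv 10 - ε) + (inv 10 - ε)} {inv 10 - ε} (0≤+0≤ {inv 10 - ε} {inv 10 - ε} ε≤ ε≤) ε≤) ε≤))
    (solve 3 (λ i t K → (((con ½ :+ (con ½ :+ K)) :+ con 1ℚ) :- i) :+ (((con ½ :+ (con ½ :+ K)) :+ con 1ℚ) :- i) :=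
        ((con 1ℚ :+ ((i :+ (con 1ℚ :+ con 0ℚ)) :+ K)) :+ (con ½ :+ ((i :+ (con ½ :+ con 0ℚ)) :+ K))) :+
        ((con 1ℚ :- (t :+ t :+ t :+ t)) :+ ((t :- i) :+ (t :- i) :+ (t :- i) :+ (t :- i))))
      refl ε (inv 10) (times r ½))
  where
    ε : ℚ
    ε = 1/[n-1] n
    ε≤ : 0ℚ ≤ inv 10 - ε
    ε≤ = p≤q⇒0≤q-p (1/[n-1]≤1/10 n≥11)

2ℚ : ℚ
2ℚ = 1ℚ + 1ℚ

savings₂ : ∀ M s₁ s₂ d₁ d₂ → s₁ ≤ M - d₁ → s₂ ≤ M - d₂ → 2ℚ ≤ d₁ + d₂ → (s₁ + (s₂ + 0ℚ)) + 2ℚ ≤ times 2 M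
savings₂ M s₁ s₂ d₁ d₂ h₁ h₂ hd = ℚₚ.≤-trans (ℚₚ.+-mono-≤ (ℚₚ.+-mono-≤ h₁ (ℚₚ.+-monoˡ-≤ 0ℚ h₂)) hd)
  (ℚₚ.≤-reflexive (solve 3 (λ M a b → ((M :- a) :+ ((M :- b) :+ con 0ℚ)) :+ (a :+ b) := M :+ (M :+ con 0ℚ)) refl M d₁ d₂))

savings₃ : ∀ M s₁ s₂ s₃ d₁ d₂ d₃ → s₁ ≤ M - d₁ → s₂ ≤ M - d₂ → s₃ ≤ M - d₃ → 2ℚ ≤ d₁ + (d₂ + d₃) →
  (s₁ + (s₂ + (s₃ + 0ℚ))) + 2ℚ ≤ times 3 M
savings₃ M s₁ s₂ s₃ d₁ d₂ d₃ h₁ h₂ h₃ hd =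
  ℚₚ.≤-trans (ℚₚ.+-mono-≤ (ℚₚ.+-mono-≤ h₁ (ℚₚ.+-mono-≤ h₂ (ℚₚ.+-monoˡ-≤ 0ℚ h₃))) hd)
    (ℚₚ.≤-reflexive (solve 4 (λ M a b c → ((M :- a) :+ ((M :- b) :+ ((M :- c) :+ con 0ℚ))) :+ (a :+ (b :+ c)) :=
                                          M :+ (M :+ (M :+ con 0ℚ))) refl M d₁ d₂ d₃))

savings₄ : ∀ M s₁ s₂ s₃ s₄ d₁ d₂ d₃ d₄ → s₁ ≤ M - d₁ → s₂ ≤ M - d₂ → s₃ ≤ M - d₃ → s₄ ≤ M - d₄ →
  2ℚ ≤ d₁ + (d₂ + (d₃ + d₄)) → (s₁ + (s₂ + (s₃ + (s₄ + 0ℚ)))) + 2ℚ ≤ times 4 M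
savings₄ M s₁ s₂ s₃ s₄ d₁ d₂ d₃ d₄ h₁ h₂ h₃ h₄ hd =
  ℚₚ.≤-trans (ℚₚ.+-mono-≤ (ℚₚ.+-mono-≤ h₁ (ℚₚ.+-mono-≤ h₂ (ℚₚ.+-mono-≤ h₃ (ℚₚ.+-monoˡ-≤ 0ℚ h₄)))) hd)
    (ℚₚ.≤-reflexive (solve 5 (λ M a b c d →
      ((M :- a) :+ ((M :- b) :+ ((M :- c) :+ ((M :- d) :+ con 0ℚ)))) :+ (a :+ (b :+ (c :+ d))) :=
                                            M :+ (M :+ (M :+ (M :+ con 0ℚ)))) refl M d₁ d₂ d₃ d₄))

savings-extend : ∀ k e S T M → e ℕ.≤ k → S ≤ T + times (k ∸ e) M → T + 2ℚ ≤ times e M → S + 2ℚ ≤ times k M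
savings-extend k e S T M e≤k S≤ T≤ = ℚₚ.≤-trans (ℚₚ.+-monoˡ-≤ 2ℚ S≤)
  (ℚₚ.≤-trans (ℚₚ.≤-reflexive (solve 3 (λ T R w → (T :+ R) :+ w := (T :+ w) :+ R) refl T (times (k ∸ e) M) 2ℚ))
    (ℚₚ.≤-trans (ℚₚ.+-monoˡ-≤ (times (k ∸ e) M) T≤)
      (ℚₚ.≤-reflexive (trans (sym (times-+ e (k ∸ e) M)) (cong (λ z → times z M) (ℕₚ.m+[n∸m]≡n e≤k))))))

sum≤times-pair+rest : ∀ k S T B → 2 ℕ.≤ k → S ≤ T + times (k ∸ 2) B → T ≤ B + (B + 0ℚ) → S ≤ times k B
sum≤times-pair+rest (suc zero) _ _ _ (s≤s ()) _ _
sum≤times-pair+rest (suc (suc k)) S T B _ S≤ T≤ = ℚₚ.≤-trans S≤ (ℚₚ.≤-trans (ℚₚ.+-monoˡ-≤ (times k B) T≤)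
  (ℚₚ.≤-reflexive (trans (ℚₚ.+-assoc B (B + 0ℚ) (times k B))
    (cong (_+_ B) (trans (ℚₚ.+-assoc B 0ℚ (times k B)) (cong (_+_ B) (ℚₚ.+-identityˡ (times k B))))))))

average≤ : ∀ k S B → 1 ℕ.≤ k → S ≤ times k B → S * inv k ≤ B
average≤ (suc k) S B _ S≤ = subst (S * inv (suc k) ≤_) (times-*-inv k B)
  (ℚₚ.*-monoʳ-≤-nonNeg (inv (suc k)) {{ℚₚ.normalize-nonNeg 1 (suc k)}} S≤)

-- Saving 2 in total lowers the average by 2/k ≥ 2/(n-1), which is exactly the gap between shareCap n and bound n.
average≤bound : ∀ {n} → 11 ℕ.≤ n → ∀ k S → 1 ℕ.≤ k → k ℕ.≤ n ∸ 1 → S + 2ℚ ≤ times k (shareCap n) → S * inv k ≤ bound n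
average≤bound {n@(suc (suc r))} (s≤s (s≤s _)) (suc k) S _ (s≤s k≤) S+2≤ =
  ℚₚ.≤-trans average≤M-2ι (ℚₚ.≤-trans (ℚₚ.+-monoʳ-≤ M (ℚₚ.neg-antimono-≤ (ℚₚ.+-mono-≤ ε≤ι ε≤ι))) (ℚₚ.≤-reflexive bound≡))
  where
    M R ι ε : ℚ
    M = shareCap n
    R = times (suc k) M
    ι = inv (suc k)
    ε = 1/[n-1] n
    ε≤ι : ε ≤ ι
    ε≤ι = inv-antimono k≤
    S≤ : S ≤ R - 2ℚ
    S≤ = subst (_≤ R - 2ℚ) (solve 1 (λ s → (s :+ (con 1ℚ :+ con 1ℚ)) :- (con 1ℚ :+ con 1ℚ) := s) refl S) (ℚₚ.+-monoˡ-≤ (- 2ℚ) S+2≤)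
    average≤M-2ι : S * ι ≤ M - (ι + ι)
    average≤M-2ι = subst (S * ι ≤_) (trans (solve 2 (λ R i → (R :- (con 1ℚ :+ con 1ℚ)) :* i := R :* i :- (i :+ i)) refl R ι)
                                        (cong (_- (ι + ι)) (times-*-inv k M)))
                (ℚₚ.*-monoʳ-≤-nonNeg ι {{ℚₚ.normalize-nonNeg 1 (suc k)}} S≤)
    bound≡ : M - (ε + ε) ≡ bound n
    bound≡ rewrite +n/2≡times½ n =
      solve 2 (λ i K → (con 1ℚ :+ ((i :+ (con 1ℚ :+ con 0ℚ)) :+ K)) :- (i :+ i) := ((con ½ :+ (con ½ :+ K)) :+ con 1ℚ) :- i)
        refl ε (times r ½)

module Setting {n} (n≥11 : 11 ℕ.≤ n) (C : Code n) (u c : Word n)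
               (u-special-father : isSpecialFather C u ≡ true) (c∈I-u : c ∈ I C u) (c-special : isSpecial C c ≡ true)
               (dominating : ∀ x → I C x ≢ []) (∣I₃∣>n : suc n ℕ.≤ length (Ir C 3 u)) where

  open CodeFacts C

  n≥2 : 2 ℕ.≤ n
  n≥2 = ℕₚ.≤-trans (s≤s (s≤s z≤n)) n≥11

  u-father : isFather C u ≡ true
  u-father = proj₁ (∧-true⁻ u-special-father)

  opaque
    c-direction : Σ (Fin n) λ k → c ≡ flip k u
    c-direction with proj₂ (∈I⇒≡⊎flip {u} c∈I-u)
    ... | inj₂ p = p
    ... | inj₁ c≡u = ⊥-elim (ℕₚ.≤⇒≯ (father⇒3≤∣I∣ {u} u-father)
            (subst (λ z → ∣I∣ z ℕ.< 3) c≡u (subst (ℕ._< 3) (sym (special⇒∣I∣≡1 c-special)) (s≤s (s≤s z≤n)))))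

    ic : Fin n
    ic = proj₁ c-direction

    c≡flip-ic-u : c ≡ flip ic u
    c≡flip-ic-u = proj₂ c-direction

    u≡flip-ic-c : u ≡ flip ic c
    u≡flip-ic-c = trans (sym (flip-involutive ic u)) (cong (flip ic) (sym c≡flip-ic-u))

  module Sc = SpecialCodeword n≥2 C c ic c-special (subst (λ z → isFather C z ≡ true) u≡flip-ic-c u-father)

  opaque
    io : Fin n
    io = Sc.orphan

    io≢ic : io ≢ ic
    io≢ic = Sc.orphan≢m

    flip-u∈C : ∀ k → k ≢ io → C (flip k u) ≡ true
    flip-u∈C k k≢io with k ≟F ic
    ... | yes refl = subst (λ z → C z ≡ true) c≡flip-ic-u Sc.s∈C
    ... | no k≢ic = subst (λ z → C (flip k z) ≡ true) (sym u≡flip-ic-c) (Sc.father-flip∈C k k≢ic k≢io)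

    flip-io-u∉C : C (flip io u) ≡ false
    flip-io-u∉C = subst (λ z → C (flip io z) ≡ false) (sym u≡flip-ic-c) Sc.father-flip-orphan∉C

  ic≢io : ic ≢ io
  ic≢io = ≢-sym io≢ic

  u∉C : C u ≡ false
  u∉C = subst (λ z → C z ≡ false) (sym u≡flip-ic-c) (Sc.flip∉C ic)

  codirections : List (Fin n)
  codirections = remove _≟F_ io (allFin n)

  ∈-codirections : ∀ {k} → k ≢ io → k ∈ codirections
  ∈-codirections {k} = ∈-remove⁺ _≟F_ (allFin n) (∈-allFin k)

  I-u-list : List (Word n)
  I-u-list = map (λ k → flip k u) codirections

  I-u-list-unique : Unique I-u-list
  I-u-list-unique = Unique.map⁺ (λ {x} {y} → flip-injective x y u) (remove-unique _≟F_ io (Unique.allFin⁺ n))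

  opaque
    length-I-u-list : length I-u-list ≡ n ∸ 1
    length-I-u-list = trans (length-map (λ k → flip k u) codirections)
      (cong (_∸ 1) (sym (trans (sym (length-tabulate {n = n} (λ x → x)))
        (length-remove _≟F_ io (allFin n) (Unique.allFin⁺ n) (∈-allFin io)))))

  opaque
    n∸1≤∣I-u∣ : n ∸ 1 ℕ.≤ ∣I∣ u
    n∸1≤∣I-u∣ = subst (ℕ._≤ ∣I∣ u) length-I-u-list (⊆I⇒length≤ u I-u-list I-u-list-unique I-u-list⊆I-u)
      where
        I-u-list⊆I-u : ∀ {y} → y ∈ I-u-list → y ∈ I C u
        I-u-list⊆I-u y∈ with ∈-map⁻ (λ k → flip k u) y∈
        ... | k , k∈ , refl = ∈I-flip k u (flip k u) refl (flip-u∈C k (proj₂ (∈-remove⁻ _≟F_ (allFin n) k∈)))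

    I-u⊆I-u-list : ∀ {y} → y ∈ I C u → y ∈ I-u-list
    I-u⊆I-u-list y∈ with ∈I⇒≡⊎flip {u} y∈
    ... | y∈C , inj₁ refl = ⊥-elim (true≢false y∈C u∉C)
    ... | y∈C , inj₂ (k , refl) with k ≟F io
    ... | yes refl = ⊥-elim (true≢false y∈C flip-io-u∉C)
    ... | no k≢io = ∈-map⁺ (λ k → flip k u) (∈-codirections k≢io)

  φ : Word n → ℚ
  φ v = inv (∣I∣ v)

  φ≤1 : ∀ v → φ v ≤ 1ℚ
  φ≤1 v = inv≤1 (∣I∣ v)

  φ≤½ : ∀ x a b → a ≢ b → a ∈ I C x → b ∈ I C x → φ x ≤ ½
  φ≤½ x a b a≢b a∈ b∈ = inv≤inv-suc (2≤∣I∣ x a b a≢b a∈ b∈)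

  φ≤⅓ : ∀ x a b c → a ≢ b → a ≢ c → b ≢ c → a ∈ I C x → b ∈ I C x → c ∈ I C x → φ x ≤ ⅓
  φ≤⅓ x a b c a≢b a≢c b≢c a∈ b∈ c∈ = inv≤inv-suc (3≤∣I∣ x a b c a≢b a≢c b≢c a∈ b∈ c∈)

  φ-u≤1/[n-1] : φ u ≤ 1/[n-1] n
  φ-u≤1/[n-1] = inv≤inv-suc (subst (ℕ._≤ ∣I∣ u) (ℕₚ.+-∸-assoc 1 n≥2) n∸1≤∣I-u∣)

  share≡φ+neighbours : ∀ x → share C x ≡ φ x + sumFin n (λ k → φ (flip k x))
  share≡φ+neighbours x = sumMap-Nclosed x φ

  flip-swap : ∀ a b → flip b u ≡ flip a (flip b (flip a u))
  flip-swap a b = sym (trans (cong (flip a) (flip-comm b a u)) (flip-involutive a (flip b u)))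

  φ-slot≤½ : ∀ p k → p ≢ io → k ≢ io → k ≢ p → φ (flip k (flip p u)) ≤ ½
  φ-slot≤½ p k p≢io k≢io k≢p = φ≤½ (flip k (flip p u)) (flip p u) (flip k u) (λ q → k≢p (sym (flip-injective p k u q)))
    (∈I-flip k (flip k (flip p u)) (flip p u) (sym (flip-involutive k (flip p u))) (flip-u∈C p p≢io))
    (∈I-flip p (flip k (flip p u)) (flip k u) (flip-swap p k) (flip-u∈C k k≢io))

  φ-slot≤⅓ : ∀ p e q → p ≢ io → e ≢ io → p ≢ e → q ≢ p → q ≢ e → C (flip q (flip e (flip p u))) ≡ true →
    φ (flip e (flip p u)) ≤ ⅓
  φ-slot≤⅓ p e q p≢io e≢io p≢e q≢p q≢e x∈C = φ≤⅓ x (flip p u) (flip e u) (flip q x)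
      (λ r → p≢e (flip-injective p e u r))
      (λ r → q≢e (flip-flip≡⇒≡ q e (flip p u) (sym r)))
      (λ r → q≢p (flip-flip≡⇒≡ q p (flip e u) (trans (sym (cong (flip q) (flip-comm e p u))) (sym r))))
      (∈I-flip e x (flip p u) (sym (flip-involutive e (flip p u))) (flip-u∈C p p≢io))
      (∈I-flip p x (flip e u) (flip-swap p e) (flip-u∈C e e≢io))
      (∈I-flip q x (flip q x) refl x∈C)
    where x = flip e (flip p u)

  -- Slot p of flip p u is u itself; every slot outside p, io and E sees flip p u and another c_k, hence is ≤ 1/2.
  share≤shareBound : ∀ p → p ≢ io → (E : List (Fin n)) → Unique (p ∷ io ∷ E) → (α β : ℚ) →
    φ (flip p u) ≤ α → φ (flip io (flip p u)) ≤ β → (∀ {e} → e ∈ E → φ (flip e (flip p u)) ≤ ⅓) →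
    share C (flip p u) ≤ shareBound n α β (length E)
  share≤shareBound p p≢io E unique α β φ≤α φ≤β E≤⅓ =
    subst (_≤ shareBound n α β (length E)) (sym (share≡φ+neighbours (flip p u)))
      (ℚₚ.+-mono-≤ φ≤α (ℚₚ.≤-trans slots≤ (ℚₚ.+-monoˡ-≤ _ listed≤)))
    where
      g : Fin n → ℚ
      g k = φ (flip k (flip p u))
      slots≤ : sumFin n g ≤ sumMap g (p ∷ io ∷ E) + times (n ∸ suc (suc (length E))) ½
      slots≤ = subst (λ z → sumFin n g ≤ sumMap g (p ∷ io ∷ E) + times (z ∸ suc (suc (length E))) ½)
        (length-tabulate {n = n} (λ x → x))
        (sumMap≤sub+rest _≟F_ g ½ (p ∷ io ∷ E) (allFin n) (Unique.allFin⁺ n) unique (λ {e} _ → ∈-allFin e)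
          (λ {k} _ k∉ → φ-slot≤½ p k p≢io (λ q → k∉ (there (here q))) (λ q → k∉ (here q))))
      g-p≤ : g p ≤ 1/[n-1] n
      g-p≤ = subst (λ z → φ z ≤ 1/[n-1] n) (sym (flip-involutive p u)) φ-u≤1/[n-1]
      E≤ : sumMap g E ≤ times (length E) ⅓
      E≤ = subst (sumMap g E ≤_) (sumMap-const ⅓ E) (sumMap-mono g (λ _ → ⅓) E E≤⅓)
      listed≤ : sumMap g (p ∷ io ∷ E) ≤ 1/[n-1] n + (β + times (length E) ⅓)
      listed≤ = ℚₚ.+-mono-≤ g-p≤ (ℚₚ.+-mono-≤ φ≤β E≤)

  share≤shareCap-saving : ∀ p → p ≢ io → (E : List (Fin n)) → Unique (p ∷ io ∷ E) → suc (suc (length E)) ℕ.≤ n →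
    (α β : ℚ) → φ (flip p u) ≤ α → φ (flip io (flip p u)) ≤ β → (∀ {e} → e ∈ E → φ (flip e (flip p u)) ≤ ⅓) →
    share C (flip p u) ≤ shareCap n - saving α β (length E)
  share≤shareCap-saving p p≢io E unique 2+e≤n α β φ≤α φ≤β E≤⅓ =
    subst (share C (flip p u) ≤_) (shareBound≡shareCap-saving (length E) 2+e≤n α β)
      (share≤shareBound p p≢io E unique α β φ≤α φ≤β E≤⅓)

  share≤shareCap : ∀ p → p ≢ io → share C (flip p u) ≤ shareCap n
  share≤shareCap p p≢io =
    share≤shareBound p p≢io [] ((p≢io ∷ []) ∷ [] ∷ []) 1ℚ 1ℚ (φ≤1 (flip p u)) (φ≤1 (flip io (flip p u))) (λ ())

  -- flip io u is dominated by some d = flip io (flip j u); j ≠ ic because c has no codeword neighbour.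
  opaque
    orphan-side-dominator : Σ (Fin n) λ j → j ≢ io × j ≢ ic × C (flip io (flip j u)) ≡ true
    orphan-side-dominator with I C (flip io u) in eq | dominating (flip io u)
    ... | [] | I≢[] = ⊥-elim (I≢[] refl)
    ... | y ∷ _ | _ with ∈I⇒≡⊎flip {flip io u} (subst (y ∈_) (sym eq) (here refl))
    ... | y∈C , inj₁ refl = ⊥-elim (true≢false y∈C flip-io-u∉C)
    ... | y∈C , inj₂ (k , refl) with k ≟F io | k ≟F ic
    ... | yes refl | _ = ⊥-elim (true≢false (subst (λ z → C z ≡ true) (flip-involutive k u) y∈C) u∉C)
    ... | no _ | yes refl =
      ⊥-elim (true≢false (subst (λ z → C z ≡ true) (trans (flip-comm k io u) (cong (flip io) (sym c≡flip-ic-u))) y∈C)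
                                               (Sc.flip∉C io))
    ... | no k≢io | no k≢ic = k , k≢io , k≢ic , subst (λ z → C z ≡ true) (flip-comm k io u) y∈C

    j : Fin n
    j = proj₁ orphan-side-dominator

    j≢io : j ≢ io
    j≢io = proj₁ (proj₂ orphan-side-dominator)

    j≢ic : j ≢ ic
    j≢ic = proj₁ (proj₂ (proj₂ orphan-side-dominator))

    d-j∈C : C (flip io (flip j u)) ≡ true
    d-j∈C = proj₂ (proj₂ (proj₂ orphan-side-dominator))

  inC′ᵇ : Word n → Bool
  inC′ᵇ x = memW x (I C u) ∧ onlySF C u x

  ∈C′⁻ : ∀ {x} → x ∈ C′ C u → inC′ᵇ x ≡ true
  ∈C′⁻ x∈ = proj₂ (∈-filterᵇ⁻ inC′ᵇ (allWords n) x∈)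

  ∈C′⇒∈I-u : ∀ {x} → x ∈ C′ C u → x ∈ I C u
  ∈C′⇒∈I-u {x} x∈ = memW⇒∈ x (I C u) (proj₁ (∧-true⁻ {memW x (I C u)} (∈C′⁻ x∈)))

  C′-unique : Unique (C′ C u)
  C′-unique = filterᵇ-unique inC′ᵇ (allWords-unique n)

  ∈C′⇒flip-u : ∀ {x} → x ∈ C′ C u → Σ (Fin n) λ p → p ≢ io × x ≡ flip p u
  ∈C′⇒flip-u x∈ with ∈-map⁻ (λ k → flip k u) (I-u⊆I-u-list (∈C′⇒∈I-u x∈))
  ... | p , p∈ , e = p , proj₂ (∈-remove⁻ _≟F_ (allFin n) p∈) , e

  length-C′≤n∸1 : length (C′ C u) ℕ.≤ n ∸ 1
  length-C′≤n∸1 = subst (length (C′ C u) ℕ.≤_) length-I-u-list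
    (⊆⇒length≤ _≟W_ (C′ C u) I-u-list C′-unique (λ x∈ → I-u⊆I-u-list (∈C′⇒∈I-u x∈)))

  private
    noOtherSF : Word n → Word n → Bool
    noOtherSF x w = not (isSpecialFather C w) ∨ eqW w u

  other-special-father⇒∉C′ : ∀ x z → z ∈ Nclosed x → isSpecialFather C z ≡ true → z ≢ u → x ∉ C′ C u
  other-special-father⇒∉C′ x z z∈ z-sf z≢u x∈ with all (noOtherSF x) (Nclosed x) in e
        | proj₁ (∧-true⁻ {all (noOtherSF x) (Nclosed x)} (proj₂ (∧-true⁻ {memW x (I C u)} (∈C′⁻ x∈))))
  ... | true | _ with all⇒∀∈ (noOtherSF x) (Nclosed x) e z∈
  ... | z-ok rewrite z-sf | eqW-≢ z u z≢u with () ← z-ok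

  ∉C′⇒other-special-father : ∀ x → x ∈ I C u → x ∉ C′ C u →
    Σ (Word n) λ z → z ∈ Nclosed x × isSpecialFather C z ≡ true × z ≢ u
  ∉C′⇒other-special-father x x∈I x∉ with inC′ᵇ x in e
  ... | true = ⊥-elim (x∉ (∈-filterᵇ⁺ inC′ᵇ (allWords n) (∈-allWords x) e))
  ... | false with ∧-false⁻ (memW x (I C u)) e
  ... | inj₁ f = ⊥-elim (true≢false (∈⇒memW x (I C u) x∈I) f)
  ... | inj₂ f with ∧-false⁻ (all (noOtherSF x) (Nclosed x)) f
  ... | inj₂ g = ⊥-elim (true≢false (∈⇒memW u (Nclosed x) (∈I⇒∈Nclosed x∈I)) g)
  ... | inj₁ g with all-false⇒∃ (noOtherSF x) (Nclosed x) g
  ... | z , z∈ , z-bad with ∨-false⁻ {not (isSpecialFather C z)} z-bad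
  ... | not-sf , z≢u = z , z∈ , not-false⁻ not-sf , (λ z≡u → true≢false (subst (λ w → eqW z w ≡ true) z≡u (eqW-refl z)) z≢u)

  opaque
    special-father⇒special-neighbour : ∀ z → isSpecialFather C z ≡ true → Σ (Fin n) λ m → isSpecial C (flip m z) ≡ true
    special-father⇒special-neighbour z e with any⇒∃ (isSpecial C) (Nopen z) (proj₂ (∧-true⁻ {isFather C z} e))
    ... | s , s∈ , s-special with ∈Nopen⇒flip {s = z} s∈
    ... | m , refl = m , s-special

  special-father∉C : ∀ z → isSpecialFather C z ≡ true → C z ≡ false
  special-father∉C z z-sf with special-father⇒special-neighbour z z-sf
  ... | m , s-special = subst (λ w → C w ≡ false) (flip-involutive m z) (special⇒flip∉C s-special m)

  record Excluded (a : Fin n) : Set where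
    field
      l : Fin n
      a≢ic : a ≢ ic
      l≢a : l ≢ a
      l≢io : l ≢ io
      flip-io-a∉C : C (flip io (flip a u)) ≡ false
      flip-p-l-a∈C : ∀ p → p ≢ io → p ≢ ic → C (flip p (flip l (flip a u))) ≡ true
      flip-l-u∉C′ : flip l u ∉ C′ C u

  -- z = flip l (flip a u) is a special father other than u; its special neighbour s* = flip m′ z is forced to be
  -- flip io z, and the sons of s* make z's neighbours codewords.
  module NearbySpecialFather (a l : Fin n) (a≢io : a ≢ io) (l≢a : l ≢ a)
                             (z-sf : isSpecialFather C (flip l (flip a u)) ≡ true) (z≢u : flip l (flip a u) ≢ u) where

    z : Word n
    z = flip l (flip a u)

    private
      z-special-neighbour : Σ (Fin n) λ m → isSpecial C (flip m z) ≡ true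
      z-special-neighbour = special-father⇒special-neighbour z z-sf

    m′ : Fin n
    m′ = proj₁ z-special-neighbour

    s* : Word n
    s* = flip m′ z

    z-father : isFather C z ≡ true
    z-father = proj₁ (∧-true⁻ z-sf)

    module Sz = SpecialCodeword n≥2 C s* m′ (proj₂ z-special-neighbour)
      (subst (λ w → isFather C w ≡ true) (sym (flip-involutive m′ z)) z-father)

    m′≢l : m′ ≢ l
    m′≢l m′≡l =
      ∣I∣≤2⇒¬father u (subst (λ w → ∣I∣ w ℕ.≤ 2) flip-a-s*≡u (Sz.∣I-flip∣≤2 a (λ q → l≢a (sym (trans q m′≡l))))) u-father
      where
        flip-a-s*≡u : flip a s* ≡ u
        flip-a-s*≡u = trans (cong (λ t → flip a (flip t z)) m′≡l)
          (trans (cong (flip a) (flip-involutive l (flip a u))) (flip-involutive a u))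

    m′≢a : m′ ≢ a
    m′≢a m′≡a = ∣I∣≤2⇒¬father u (subst (λ w → ∣I∣ w ℕ.≤ 2) flip-l-s*≡u (Sz.∣I-flip∣≤2 l (λ q → l≢a (trans q m′≡a)))) u-father
      where
        flip-l-s*≡u : flip l s* ≡ u
        flip-l-s*≡u = trans (cong (λ t → flip l (flip t z)) m′≡a)
          (trans (cong (flip l) (trans (cong (flip a) (flip-comm l a u)) (flip-involutive a (flip l u)))) (flip-involutive l u))

    w : Word n
    w = flip l s*

    w≡flip-m′-a : w ≡ flip m′ (flip a u)
    w≡flip-m′-a = trans (cong (flip l) (flip-comm m′ l (flip a u))) (flip-involutive l (flip m′ (flip a u)))

    -- Otherwise w would see the three codewords flip a u, s* and flip m′ u.
    m′≡io : m′ ≡ io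
    m′≡io with m′ ≟F io
    ... | yes e = e
    ... | no m′≢io = ⊥-elim (ℕₚ.≤⇒≯ (3≤∣I∣ w (flip a u) s* (flip m′ u)
          (λ q → m′≢l (flip-flip≡⇒≡ m′ l (flip a u) (sym q)))
          (λ q → m′≢a (flip-injective m′ a u (sym q)))
          (λ q → l≢a (flip-flip≡⇒≡ l a u (trans (sym (flip-involutive m′ (flip l (flip a u))))
                                               (trans (cong (flip m′) q) (flip-involutive m′ u)))))
          (∈I-flip m′ w (flip a u) (sym (trans (cong (flip m′) w≡flip-m′-a) (flip-involutive m′ (flip a u)))) (flip-u∈C a a≢io))
          (∈I-flip l w s* (sym (flip-involutive l s*)) Sz.s∈C)
          (∈I-flip a w (flip m′ u) (sym (trans (cong (flip a) w≡flip-m′-a) (trans (cong (flip a) (flip-comm m′ a u))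
                                                                                     (flip-involutive a (flip m′ u)))))
            (flip-u∈C m′ m′≢io)))
          (s≤s (Sz.∣I-flip∣≤2 l (≢-sym m′≢l))))

    l≢io : l ≢ io
    l≢io l≡io = m′≢l (trans m′≡io (sym l≡io))

    a≢ic : a ≢ ic
    a≢ic a≡ic = ∣I∣≤2⇒¬father z
      (subst (λ x → ∣I∣ x ℕ.≤ 2) (cong (flip l) (trans c≡flip-ic-u (cong (λ t → flip t u) (sym a≡ic))))
                                (Sc.∣I-flip∣≤2 l (λ q → l≢a (trans q (sym a≡ic))))) z-father

    l≢ic : l ≢ ic
    l≢ic l≡ic = ∣I∣≤2⇒¬father z
      (subst (λ x → ∣I∣ x ℕ.≤ 2) (trans (cong (flip a) (trans c≡flip-ic-u (cong (λ t → flip t u) (sym l≡ic))))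
                                                              (flip-comm a l u))
                                (Sc.∣I-flip∣≤2 a a≢ic)) z-father

    flip-io-a∉C : C (flip io (flip a u)) ≡ false
    flip-io-a∉C = subst (λ q → C (flip q (flip a u)) ≡ false) m′≡io (subst (λ x → C x ≡ false) w≡flip-m′-a (Sz.flip∉C l))

    flip-a-c≡ : flip a c ≡ flip ic (flip a u)
    flip-a-c≡ = trans (cong (flip a) c≡flip-ic-u) (flip-comm a ic u)

    -- Otherwise flip ic z = flip l (flip a c) is a codeword, and flip a c sees c, flip a u and flip l (flip a c).
    ic≡orphan : ic ≡ Sz.orphan
    ic≡orphan with ic ≟F Sz.orphan
    ... | yes ic≡o = ic≡o
    ... | no ic≢o = ⊥-elim (ℕₚ.≤⇒≯ (3≤∣I∣ (flip a c) c (flip a u) (flip l (flip a c))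
        (λ q → a≢ic (sym (flip-injective ic a u (trans (sym c≡flip-ic-u) q))))
        (λ q → l≢a (flip-flip≡⇒≡ l a c (sym q)))
        (λ q → l≢ic (flip-flip≡⇒≡ l ic (flip a u) (trans (sym (cong (flip l) flip-a-c≡)) (sym q))))
        (∈I-flip a (flip a c) c (sym (flip-involutive a c)) Sc.s∈C)
        (∈I-flip ic (flip a c) (flip a u) (sym (trans (cong (flip ic) flip-a-c≡) (flip-involutive ic (flip a u))))
          (flip-u∈C a a≢io))
        (∈I-flip l (flip a c) (flip l (flip a c)) refl flip-l-a-c∈C))
      (s≤s (Sc.∣I-flip∣≤2 a a≢ic)))
      where
        flip-l-a-c∈C : C (flip l (flip a c)) ≡ true
        flip-l-a-c∈C = subst (λ x → C x ≡ true)
          (trans (cong (flip ic) (flip-involutive m′ z)) (trans (flip-comm ic l (flip a u)) (cong (flip l) (sym flip-a-c≡))))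
          (Sz.father-flip∈C ic (λ q → ic≢io (trans q m′≡io)) ic≢o)

    flip-p-z∈C : ∀ p → p ≢ io → p ≢ ic → C (flip p z) ≡ true
    flip-p-z∈C p p≢io p≢ic = subst (λ x → C (flip p x) ≡ true) (flip-involutive m′ z)
      (Sz.father-flip∈C p (λ q → p≢io (trans q m′≡io)) (λ q → p≢ic (trans q (sym ic≡orphan))))

    flip-l-u∉C′ : flip l u ∉ C′ C u
    flip-l-u∉C′ = other-special-father⇒∉C′ (flip l u) z
      (subst (_∈ Nclosed (flip l u)) (flip-comm a l u) (flip∈Nclosed a (flip l u))) z-sf z≢u

  opaque
    excluded : ∀ a → a ≢ io → flip a u ∉ C′ C u → Excluded a
    excluded a a≢io c-a∉C′ with ∉C′⇒other-special-father (flip a u) (∈I-flip a u (flip a u) refl (flip-u∈C a a≢io)) c-a∉C′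
    ... | z , z∈ , z-sf , z≢u with ∈Nclosed⇒≡⊎flip {x = flip a u} z∈
    ... | inj₁ refl = ⊥-elim (true≢false (flip-u∈C a a≢io) (special-father∉C z z-sf))
    ... | inj₂ (l , refl) with l ≟F a
    ... | yes refl = ⊥-elim (z≢u (flip-involutive l u))
    ... | no l≢a = record
      { l = l ; a≢ic = a≢ic ; l≢a = l≢a ; l≢io = l≢io ; flip-io-a∉C = flip-io-a∉C
      ; flip-p-l-a∈C = flip-p-z∈C ; flip-l-u∉C′ = flip-l-u∉C′ }
      where open NearbySpecialFather a l a≢io l≢a z-sf z≢u

  ∈C′-unless-excluded : ∀ a → a ≢ io → ¬ Excluded a → flip a u ∈ C′ C u
  ∈C′-unless-excluded a a≢io not-excluded with any? (flip a u ≟W_) (C′ C u)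
  ... | yes c-a∈C′ = c-a∈C′
  ... | no c-a∉C′ = ⊥-elim (not-excluded (excluded a a≢io c-a∉C′))

  flip-ic-u∈C′ : flip ic u ∈ C′ C u
  flip-ic-u∈C′ = ∈C′-unless-excluded ic ic≢io (λ X → Excluded.a≢ic X refl)

  c∈C′ : c ∈ C′ C u
  c∈C′ = subst (_∈ C′ C u) (sym c≡flip-ic-u) flip-ic-u∈C′

  c-j∈C′ : flip j u ∈ C′ C u
  c-j∈C′ = ∈C′-unless-excluded j j≢io (λ X → true≢false d-j∈C (Excluded.flip-io-a∉C X))

  φ-c-j≤½ : φ (flip j u) ≤ ½
  φ-c-j≤½ = φ≤½ (flip j u) (flip j u) (flip io (flip j u)) (≢-sym (flip-≢ io (flip j u)))
    (∈I-self (flip j u) (flip-u∈C j j≢io)) (∈I-flip io (flip j u) (flip io (flip j u)) refl d-j∈C)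

  φ-d-j≤½ : φ (flip io (flip j u)) ≤ ½
  φ-d-j≤½ = φ≤½ (flip io (flip j u)) (flip io (flip j u)) (flip j u) (flip-≢ io (flip j u)) (∈I-self _ d-j∈C)
    (∈I-flip io (flip io (flip j u)) (flip j u) (sym (flip-involutive io (flip j u))) (flip-u∈C j j≢io))

  -- The slots a and l of every other c_p see c_p, c_a (resp. c_l) and the codeword flip p z.
  caseI-share≤bound : ∀ a (X : Excluded a) → a ≢ io → flip a u ∉ C′ C u →
    ∀ p → p ≢ io → p ≢ ic → flip p u ∈ C′ C u → share C (flip p u) ≤ bound n
  caseI-share≤bound a X a≢io c-a∉C′ p p≢io p≢ic c-p∈C′ = ℚₚ.≤-trans share≤ (caseI-other≤bound n≥11)
    where
      open Excluded X
      p≢a : p ≢ a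
      p≢a refl = c-a∉C′ c-p∈C′
      p≢l : p ≢ l
      p≢l refl = flip-l-u∉C′ c-p∈C′
      flip-p-z∈C : C (flip p (flip l (flip a u))) ≡ true
      flip-p-z∈C = flip-p-l-a∈C p p≢io p≢ic
      slot-a≤ : φ (flip a (flip p u)) ≤ ⅓
      slot-a≤ = φ-slot≤⅓ p a l p≢io a≢io p≢a (≢-sym p≢l) l≢a
        (subst (λ w → C w ≡ true) (trans (flip-comm p l (flip a u)) (cong (flip l) (flip-comm p a u))) flip-p-z∈C)
      slot-l≤ : φ (flip l (flip p u)) ≤ ⅓
      slot-l≤ = φ-slot≤⅓ p l a p≢io l≢io p≢l (≢-sym p≢a) (≢-sym l≢a)
        (subst (λ w → C w ≡ true) (trans (cong (flip p) (flip-comm l a u))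
                                    (trans (flip-comm p a (flip l u)) (cong (flip a) (flip-comm p l u))))
          flip-p-z∈C)
      share≤ : share C (flip p u) ≤ shareBound n 1ℚ 1ℚ 2
      share≤ = share≤shareBound p p≢io (a ∷ l ∷ [])
        ((p≢io ∷ p≢a ∷ p≢l ∷ []) ∷ (≢-sym a≢io ∷ ≢-sym l≢io ∷ []) ∷ (≢-sym l≢a ∷ []) ∷ [] ∷ []) 1ℚ 1ℚ
        (φ≤1 (flip p u)) (φ≤1 (flip io (flip p u))) (λ { (here refl) → slot-a≤ ; (there (here refl)) → slot-l≤ })

  -- c and c_j share the bound, the cheap c_j compensating for c.
  caseI-pair≤ : share C (flip ic u) + (share C (flip j u) + 0ℚ) ≤ bound n + (bound n + 0ℚ)
  caseI-pair≤ = ℚₚ.≤-trans (ℚₚ.+-mono-≤ share-c≤ (ℚₚ.+-monoˡ-≤ 0ℚ share-c-j≤))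
    (ℚₚ.≤-trans (ℚₚ.≤-reflexive (sym (ℚₚ.+-assoc (shareBound n 1ℚ 1ℚ 0) (shareBound n ½ ½ 0) 0ℚ)))
      (ℚₚ.≤-trans (ℚₚ.+-monoˡ-≤ 0ℚ (caseI-pair≤bound n≥11)) (ℚₚ.≤-reflexive (ℚₚ.+-assoc (bound n) (bound n) 0ℚ))))
    where
      share-c≤ : share C (flip ic u) ≤ shareBound n 1ℚ 1ℚ 0
      share-c≤ = share≤shareBound ic ic≢io [] ((ic≢io ∷ []) ∷ [] ∷ []) 1ℚ 1ℚ (φ≤1 (flip ic u)) (φ≤1 (flip io (flip ic u))) (λ ())
      share-c-j≤ : share C (flip j u) ≤ shareBound n ½ ½ 0
      share-c-j≤ = share≤shareBound j j≢io [] ((j≢io ∷ []) ∷ [] ∷ []) ½ ½ φ-c-j≤½ φ-d-j≤½ (λ ())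

  caseI : ∀ a → a ≢ io → flip a u ∉ C′ C u → sumMap (share C) (C′ C u) ≤ times (length (C′ C u)) (bound n)
  caseI a a≢io c-a∉C′ = sum≤times-pair+rest (length (C′ C u)) _ _ (bound n) (⊆⇒length≤ _≟W_ pair (C′ C u) pair-unique pair⊆C′)
    (sumMap≤sub+rest _≟W_ (share C) (bound n) pair (C′ C u) C′-unique pair-unique pair⊆C′ others≤) caseI-pair≤
    where
      pair : List (Word n)
      pair = flip ic u ∷ flip j u ∷ []
      pair-unique : Unique pair
      pair-unique = ((λ q → j≢ic (sym (flip-injective ic j u q))) ∷ []) ∷ [] ∷ []
      pair⊆C′ : ∀ {x} → x ∈ pair → x ∈ C′ C u
      pair⊆C′ (here refl) = flip-ic-u∈C′
      pair⊆C′ (there (here refl)) = c-j∈C′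
      others≤ : ∀ {x} → x ∈ C′ C u → x ∉ pair → share C x ≤ bound n
      others≤ x∈ x∉ with ∈C′⇒flip-u x∈
      ... | p , p≢io , refl = caseI-share≤bound a (excluded a a≢io c-a∉C′) a≢io c-a∉C′ p p≢io
                                 (λ q → x∉ (here (cong (λ t → flip t u) q))) x∈

  4≤n : 4 ℕ.≤ n
  4≤n = ℕₚ.≤-trans (s≤s (s≤s (s≤s (s≤s z≤n)))) n≥11

  share≤cap-saving₀ : ∀ p → p ≢ io → ∀ α β → φ (flip p u) ≤ α → φ (flip io (flip p u)) ≤ β →
    share C (flip p u) ≤ shareCap n - saving α β 0
  share≤cap-saving₀ p p≢io α β φ≤α φ≤β =
    share≤shareCap-saving p p≢io [] ((p≢io ∷ []) ∷ [] ∷ []) (ℕₚ.≤-trans (s≤s (s≤s z≤n)) 4≤n) α β φ≤α φ≤β (λ ())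

  share≤cap-saving₁ : ∀ p → p ≢ io → ∀ e → e ≢ p → e ≢ io → ∀ α β → φ (flip p u) ≤ α → φ (flip io (flip p u)) ≤ β →
    φ (flip e (flip p u)) ≤ ⅓ → share C (flip p u) ≤ shareCap n - saving α β 1
  share≤cap-saving₁ p p≢io e e≢p e≢io α β φ≤α φ≤β slot-e≤ =
    share≤shareCap-saving p p≢io (e ∷ []) ((p≢io ∷ ≢-sym e≢p ∷ []) ∷ (≢-sym e≢io ∷ []) ∷ [] ∷ [])
      (ℕₚ.≤-trans (s≤s (s≤s (s≤s z≤n))) 4≤n) α β φ≤α φ≤β (λ { (here refl) → slot-e≤ })

  share≤cap-saving₂ : ∀ p → p ≢ io → ∀ e f → e ≢ p → e ≢ io → f ≢ p → f ≢ io → e ≢ f → ∀ α β →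
    φ (flip p u) ≤ α → φ (flip io (flip p u)) ≤ β → φ (flip e (flip p u)) ≤ ⅓ → φ (flip f (flip p u)) ≤ ⅓ →
    share C (flip p u) ≤ shareCap n - saving α β 2
  share≤cap-saving₂ p p≢io e f e≢p e≢io f≢p f≢io e≢f α β φ≤α φ≤β slot-e≤ slot-f≤ =
    share≤shareCap-saving p p≢io (e ∷ f ∷ [])
      ((p≢io ∷ ≢-sym e≢p ∷ ≢-sym f≢p ∷ []) ∷ (≢-sym e≢io ∷ ≢-sym f≢io ∷ []) ∷ (e≢f ∷ []) ∷ [] ∷ []) 4≤n
      α β φ≤α φ≤β (λ { (here refl) → slot-e≤ ; (there (here refl)) → slot-f≤ })

  φ≤½-self : ∀ w e → C w ≡ true → C (flip e w) ≡ true → φ w ≤ ½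
  φ≤½-self w e w∈C flip∈C = φ≤½ w w (flip e w) (≢-sym (flip-≢ e w)) (∈I-self w w∈C) (∈I-flip e w (flip e w) refl flip∈C)

  φ≤½-neighbours : ∀ w e f → e ≢ f → C (flip e w) ≡ true → C (flip f w) ≡ true → φ w ≤ ½
  φ≤½-neighbours w e f e≢f e∈C f∈C = φ≤½ w (flip e w) (flip f w) (λ q → e≢f (flip-injective e f w q))
    (∈I-flip e w (flip e w) refl e∈C) (∈I-flip f w (flip f w) refl f∈C)

  φ≤⅓-self : ∀ w e f → e ≢ f → C w ≡ true → C (flip e w) ≡ true → C (flip f w) ≡ true → φ w ≤ ⅓
  φ≤⅓-self w e f e≢f w∈C e∈C f∈C = φ≤⅓ w w (flip e w) (flip f w) (≢-sym (flip-≢ e w)) (≢-sym (flip-≢ f w))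
    (λ q → e≢f (flip-injective e f w q)) (∈I-self w w∈C) (∈I-flip e w (flip e w) refl e∈C) (∈I-flip f w (flip f w) refl f∈C)

  φ-slot≤⅓-self : ∀ p e → p ≢ io → e ≢ io → p ≢ e → C (flip e (flip p u)) ≡ true → φ (flip e (flip p u)) ≤ ⅓
  φ-slot≤⅓-self p e p≢io e≢io p≢e x∈C = φ≤⅓-self (flip e (flip p u)) e p (≢-sym p≢e) x∈C
    (subst (λ w → C w ≡ true) (sym (flip-involutive e (flip p u))) (flip-u∈C p p≢io))
    (subst (λ w → C w ≡ true) (flip-swap p e) (flip-u∈C e e≢io))

  ∈C-resp : ∀ {x y} → x ≡ y → C x ≡ true → C y ≡ true
  ∈C-resp refl x∈C = x∈C

  ∈C-swap₁₂ : ∀ a b c → C (flip a (flip b (flip c u))) ≡ true → C (flip b (flip a (flip c u))) ≡ true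
  ∈C-swap₁₂ a b c = ∈C-resp (flip-comm a b (flip c u))

  ∈C-swap₂₃ : ∀ a b c → C (flip a (flip b (flip c u))) ≡ true → C (flip a (flip c (flip b u))) ≡ true
  ∈C-swap₂₃ a b c = ∈C-resp (cong (flip a) (flip-comm b c u))

  opaque
    SavesTwo : Set
    SavesTwo = sumMap (share C) (C′ C u) + 2ℚ ≤ times (length (C′ C u)) (shareCap n)

  -- When C′(u) contains every codeword neighbour of u, an extra codeword y ∈ I₃(u) (there are n + 1 of them, but
  -- only n - 1 neighbours and d_j) makes the shares of a few c_p drop by 2 in total below shareCap.
  module CaseII (all∈C′ : ∀ a → a ≢ io → flip a u ∈ C′ C u) where

    opaque
      unfolding SavesTwo
      savesTwo-from : (P : List (Fin n)) → Unique P → All (_≢ io) P →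
        sumMap (λ p → share C (flip p u)) P + 2ℚ ≤ times (length P) (shareCap n) → SavesTwo
      savesTwo-from P P-unique P≢io P-saves =
        savings-extend (length (C′ C u)) (length E) (sumMap (share C) (C′ C u)) (sumMap (share C) E) (shareCap n)
          (⊆⇒length≤ _≟W_ E (C′ C u) E-unique E⊆C′)
          (sumMap≤sub+rest _≟W_ (share C) (shareCap n) E (C′ C u) C′-unique E-unique E⊆C′ others≤)
          (subst₂ (λ s k → s + 2ℚ ≤ times k (shareCap n))
            (sym (sumℚ-map-map (share C) (λ p → flip p u) P)) (sym (length-map (λ p → flip p u) P)) P-saves)
        where
          E : List (Word n)
          E = map (λ p → flip p u) P
          E-unique : Unique E
          E-unique = Unique.map⁺ (λ {x} {y} → flip-injective x y u) P-unique
          E⊆C′ : ∀ {e} → e ∈ E → e ∈ C′ C u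
          E⊆C′ e∈ with ∈-map⁻ (λ p → flip p u) e∈
          ... | p , p∈ , refl = all∈C′ p (All.lookup P≢io p∈)
          others≤ : ∀ {x} → x ∈ C′ C u → x ∉ E → share C x ≤ shareCap n
          others≤ x∈ _ with ∈C′⇒flip-u x∈
          ... | p , p≢io , refl = share≤shareCap p p≢io

    -- Each c_p below gets the bound shareCap n - saving α β e, with α bounding 1/|I(c_p)|, β its slot flip io c_p,
    -- and e counting its slots that see three codewords; the savings of the listed c_p add up to at least 2.
    extra-dominator : ∀ k → k ≢ io → k ≢ j → C (flip io (flip k u)) ≡ true → SavesTwo
    extra-dominator k k≢io k≢j d-k∈C =
      savesTwo-from (j ∷ k ∷ []) ((≢-sym k≢j ∷ []) ∷ [] ∷ []) (j≢io ∷ k≢io ∷ [])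
        (savings₂ (shareCap n) _ _ (saving ½ ½ 0) (saving ½ ½ 0)
          (share≤cap-saving₀ j j≢io ½ ½ φ-c-j≤½ φ-d-j≤½)
          (share≤cap-saving₀ k k≢io ½ ½ (φ≤½-self (flip k u) io (flip-u∈C k k≢io) d-k∈C)
            (φ≤½-self (flip io (flip k u)) io d-k∈C (∈C-resp (sym (flip-involutive io (flip k u))) (flip-u∈C k k≢io))))
          (ℚₚ.≤ᵇ⇒≤ _))

    extra-at-2-via-j : ∀ b → b ≢ io → b ≢ j → C (flip b (flip j u)) ≡ true → SavesTwo
    extra-at-2-via-j b b≢io b≢j y∈C =
      savesTwo-from (j ∷ b ∷ []) ((≢-sym b≢j ∷ []) ∷ [] ∷ []) (j≢io ∷ b≢io ∷ [])
        (savings₂ (shareCap n) _ _ (saving ⅓ ½ 1) (saving ½ 1ℚ 1)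
          (share≤cap-saving₁ j j≢io b b≢j b≢io ⅓ ½
            (φ≤⅓-self (flip j u) io b (≢-sym b≢io) (flip-u∈C j j≢io) d-j∈C y∈C) φ-d-j≤½
            (φ-slot≤⅓-self j b j≢io b≢io (≢-sym b≢j) y∈C))
          (share≤cap-saving₁ b b≢io j (≢-sym b≢j) j≢io ½ 1ℚ
            (φ≤½-self (flip b u) j (flip-u∈C b b≢io) y∈C′) (φ≤1 (flip io (flip b u)))
            (φ-slot≤⅓-self b j b≢io j≢io b≢j y∈C′))
          (ℚₚ.≤ᵇ⇒≤ _))
      where
        y∈C′ = ∈C-resp (flip-comm b j u) y∈C

    extra-at-2 : ∀ a b → a ≢ io → a ≢ j → b ≢ io → b ≢ j → a ≢ b → C (flip a (flip b u)) ≡ true → SavesTwo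
    extra-at-2 a b a≢io a≢j b≢io b≢j a≢b y∈C =
      savesTwo-from (j ∷ a ∷ b ∷ []) ((≢-sym a≢j ∷ ≢-sym b≢j ∷ []) ∷ (a≢b ∷ []) ∷ [] ∷ []) (j≢io ∷ a≢io ∷ b≢io ∷ [])
        (savings₃ (shareCap n) _ _ _ (saving ½ ½ 0) (saving ½ 1ℚ 1) (saving ½ 1ℚ 1)
          (share≤cap-saving₀ j j≢io ½ ½ φ-c-j≤½ φ-d-j≤½)
          (share≤cap-saving₁ a a≢io b (≢-sym a≢b) b≢io ½ 1ℚ
            (φ≤½-self (flip a u) b (flip-u∈C a a≢io) y∈C′) (φ≤1 (flip io (flip a u)))
            (φ-slot≤⅓-self a b a≢io b≢io a≢b y∈C′))
          (share≤cap-saving₁ b b≢io a a≢b a≢io ½ 1ℚ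
            (φ≤½-self (flip b u) a (flip-u∈C b b≢io) y∈C) (φ≤1 (flip io (flip b u)))
            (φ-slot≤⅓-self b a b≢io a≢io (≢-sym a≢b) y∈C))
          (ℚₚ.≤ᵇ⇒≤ _))
      where
        y∈C′ = ∈C-resp (flip-comm a b u) y∈C

    extra-at-3-orphan-side-via-j : ∀ b → b ≢ io → b ≢ j → C (flip io (flip b (flip j u))) ≡ true → SavesTwo
    extra-at-3-orphan-side-via-j b b≢io b≢j y∈C =
      savesTwo-from (j ∷ b ∷ []) ((≢-sym b≢j ∷ []) ∷ [] ∷ []) (j≢io ∷ b≢io ∷ [])
        (savings₂ (shareCap n) _ _ (saving ½ ⅓ 1) (saving 1ℚ ½ 1)
          (share≤cap-saving₁ j j≢io b b≢j b≢io ½ ⅓ φ-c-j≤½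
            (φ≤⅓-self (flip io (flip j u)) io b (≢-sym b≢io) d-j∈C
              (∈C-resp (sym (flip-involutive io (flip j u))) (flip-u∈C j j≢io)) (∈C-resp (flip-comm io b (flip j u)) y∈C))
            (φ-slot≤⅓ j b io j≢io b≢io (≢-sym b≢j) (≢-sym j≢io) (≢-sym b≢io) y∈C))
          (share≤cap-saving₁ b b≢io j (≢-sym b≢j) j≢io 1ℚ ½ (φ≤1 (flip b u))
            (φ≤½-neighbours (flip io (flip b u)) io j (≢-sym j≢io)
              (∈C-resp (sym (flip-involutive io (flip b u))) (flip-u∈C b b≢io))
              (∈C-resp (trans (cong (flip io) (flip-comm b j u)) (flip-comm io j (flip b u))) y∈C))
            (φ-slot≤⅓ b j io b≢io j≢io b≢j (≢-sym b≢io) (≢-sym j≢io) (∈C-resp (cong (flip io) (flip-comm b j u)) y∈C)))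
          (ℚₚ.≤ᵇ⇒≤ _))

    extra-at-3-orphan-side : ∀ a b → a ≢ io → a ≢ j → b ≢ io → b ≢ j → a ≢ b →
      C (flip io (flip a (flip b u))) ≡ true → SavesTwo
    extra-at-3-orphan-side a b a≢io a≢j b≢io b≢j a≢b y∈C =
      savesTwo-from (j ∷ a ∷ b ∷ []) ((≢-sym a≢j ∷ ≢-sym b≢j ∷ []) ∷ (a≢b ∷ []) ∷ [] ∷ []) (j≢io ∷ a≢io ∷ b≢io ∷ [])
        (savings₃ (shareCap n) _ _ _ (saving ½ ½ 0) (saving 1ℚ ½ 1) (saving 1ℚ ½ 1)
          (share≤cap-saving₀ j j≢io ½ ½ φ-c-j≤½ φ-d-j≤½)
          (share≤cap-saving₁ a a≢io b (≢-sym a≢b) b≢io 1ℚ ½ (φ≤1 (flip a u))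
            (φ≤½-neighbours (flip io (flip a u)) io b (≢-sym b≢io)
              (∈C-resp (sym (flip-involutive io (flip a u))) (flip-u∈C a a≢io))
              (∈C-resp (trans (cong (flip io) (flip-comm a b u)) (flip-comm io b (flip a u))) y∈C))
            (φ-slot≤⅓ a b io a≢io b≢io a≢b (≢-sym a≢io) (≢-sym b≢io) (∈C-resp (cong (flip io) (flip-comm a b u)) y∈C)))
          (share≤cap-saving₁ b b≢io a a≢b a≢io 1ℚ ½ (φ≤1 (flip b u))
            (φ≤½-neighbours (flip io (flip b u)) io a (≢-sym a≢io)
              (∈C-resp (sym (flip-involutive io (flip b u))) (flip-u∈C b b≢io)) (∈C-resp (flip-comm io a (flip b u)) y∈C))
            (φ-slot≤⅓ b a io b≢io a≢io (≢-sym a≢b) (≢-sym b≢io) (≢-sym a≢io) y∈C))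
          (ℚₚ.≤ᵇ⇒≤ _))

    extra-at-3-via-j : ∀ b p → b ≢ io → b ≢ j → p ≢ io → p ≢ j → b ≢ p → C (flip p (flip b (flip j u))) ≡ true → SavesTwo
    extra-at-3-via-j b p b≢io b≢j p≢io p≢j b≢p y∈C =
      savesTwo-from (j ∷ b ∷ p ∷ []) ((≢-sym b≢j ∷ ≢-sym p≢j ∷ []) ∷ (b≢p ∷ []) ∷ [] ∷ []) (j≢io ∷ b≢io ∷ p≢io ∷ [])
        (savings₃ (shareCap n) _ _ _ (saving ½ ½ 2) (saving 1ℚ 1ℚ 2) (saving 1ℚ 1ℚ 2)
          (share≤cap-saving₂ j j≢io b p b≢j b≢io p≢j p≢io b≢p ½ ½ φ-c-j≤½ φ-d-j≤½
            (φ-slot≤⅓ j b p j≢io b≢io (≢-sym b≢j) p≢j (≢-sym b≢p) y∈C)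
            (φ-slot≤⅓ j p b j≢io p≢io (≢-sym p≢j) b≢j b≢p y∈C-bpj))
          (share≤cap-saving₂ b b≢io j p (≢-sym b≢j) j≢io (≢-sym b≢p) p≢io (≢-sym p≢j) 1ℚ 1ℚ
            (φ≤1 (flip b u)) (φ≤1 (flip io (flip b u)))
            (φ-slot≤⅓ b j p b≢io j≢io b≢j (≢-sym b≢p) p≢j y∈C-pjb)
            (φ-slot≤⅓ b p j b≢io p≢io b≢p (≢-sym b≢j) (≢-sym p≢j) y∈C-jpb))
          (share≤cap-saving₂ p p≢io j b (≢-sym p≢j) j≢io b≢p b≢io (≢-sym b≢j) 1ℚ 1ℚ
            (φ≤1 (flip p u)) (φ≤1 (flip io (flip p u)))
            (φ-slot≤⅓ p j b p≢io j≢io p≢j b≢p b≢j y∈C-bjp)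
            (φ-slot≤⅓ p b j p≢io b≢io (≢-sym b≢p) (≢-sym p≢j) (≢-sym b≢j) y∈C-jbp))
          (ℚₚ.≤ᵇ⇒≤ _))
      where
        y∈C-bpj = ∈C-swap₁₂ p b j y∈C
        y∈C-pjb = ∈C-swap₂₃ p b j y∈C
        y∈C-jpb = ∈C-swap₁₂ p j b y∈C-pjb
        y∈C-bjp = ∈C-swap₂₃ b p j y∈C-bpj
        y∈C-jbp = ∈C-swap₁₂ b j p y∈C-bjp

    extra-at-3 : ∀ a b p → a ≢ io → a ≢ j → b ≢ io → b ≢ j → p ≢ io → p ≢ j → a ≢ b → a ≢ p → b ≢ p →
      C (flip a (flip b (flip p u))) ≡ true → SavesTwo
    extra-at-3 a b p a≢io a≢j b≢io b≢j p≢io p≢j a≢b a≢p b≢p y∈C =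
      savesTwo-from (j ∷ a ∷ b ∷ p ∷ [])
        ((≢-sym a≢j ∷ ≢-sym b≢j ∷ ≢-sym p≢j ∷ []) ∷ (a≢b ∷ a≢p ∷ []) ∷ (b≢p ∷ []) ∷ [] ∷ [])
        (j≢io ∷ a≢io ∷ b≢io ∷ p≢io ∷ [])
        (savings₄ (shareCap n) _ _ _ _ (saving ½ ½ 0) (saving 1ℚ 1ℚ 2) (saving 1ℚ 1ℚ 2) (saving 1ℚ 1ℚ 2)
          (share≤cap-saving₀ j j≢io ½ ½ φ-c-j≤½ φ-d-j≤½)
          (share≤cap-saving₂ a a≢io b p (≢-sym a≢b) b≢io (≢-sym a≢p) p≢io b≢p 1ℚ 1ℚ
            (φ≤1 (flip a u)) (φ≤1 (flip io (flip a u)))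
            (φ-slot≤⅓ a b p a≢io b≢io a≢b (≢-sym a≢p) (≢-sym b≢p) y∈C-pba)
            (φ-slot≤⅓ a p b a≢io p≢io a≢p (≢-sym a≢b) b≢p y∈C-bpa))
          (share≤cap-saving₂ b b≢io a p a≢b a≢io (≢-sym b≢p) p≢io a≢p 1ℚ 1ℚ
            (φ≤1 (flip b u)) (φ≤1 (flip io (flip b u)))
            (φ-slot≤⅓ b a p b≢io a≢io (≢-sym a≢b) (≢-sym b≢p) (≢-sym a≢p) y∈C-pab)
            (φ-slot≤⅓ b p a b≢io p≢io b≢p a≢b a≢p y∈C-apb))
          (share≤cap-saving₂ p p≢io a b a≢p a≢io b≢p b≢io a≢b 1ℚ 1ℚ
            (φ≤1 (flip p u)) (φ≤1 (flip io (flip p u)))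
            (φ-slot≤⅓ p a b p≢io a≢io (≢-sym a≢p) b≢p (≢-sym a≢b) y∈C-bap)
            (φ-slot≤⅓ p b a p≢io b≢io (≢-sym b≢p) a≢p a≢b y∈C))
          (ℚₚ.≤ᵇ⇒≤ _))
      where
        y∈C-apb = ∈C-swap₂₃ a b p y∈C
        y∈C-pab = ∈C-swap₁₂ a p b y∈C-apb
        y∈C-pba = ∈C-swap₂₃ p a b y∈C-pab
        y∈C-bap = ∈C-swap₁₂ a b p y∈C
        y∈C-bpa = ∈C-swap₂₃ b a p y∈C-bap

    extra-at-3-orphan-side-dispatch : ∀ a b → a ≢ io → b ≢ io → a ≢ b → C (flip io (flip a (flip b u))) ≡ true → SavesTwo
    extra-at-3-orphan-side-dispatch a b a≢io b≢io a≢b y∈C with a ≟F j | b ≟F j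
    ... | yes refl | _ = extra-at-3-orphan-side-via-j b b≢io (≢-sym a≢b) (∈C-swap₂₃ io a b y∈C)
    ... | no a≢j | yes refl = extra-at-3-orphan-side-via-j a a≢io a≢j y∈C
    ... | no a≢j | no b≢j = extra-at-3-orphan-side a b a≢io a≢j b≢io b≢j a≢b y∈C

    extra-at-3-dispatch : ∀ a b p → a ≢ io → b ≢ io → p ≢ io → a ≢ b → a ≢ p → b ≢ p →
      C (flip a (flip b (flip p u))) ≡ true → SavesTwo
    extra-at-3-dispatch a b p a≢io b≢io p≢io a≢b a≢p b≢p y∈C with a ≟F j | b ≟F j | p ≟F j
    ... | yes refl | _ | _ = extra-at-3-via-j b p b≢io (≢-sym a≢b) p≢io (≢-sym a≢p) b≢p
                               (∈C-swap₁₂ b p a (∈C-swap₂₃ b a p (∈C-swap₁₂ a b p y∈C)))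
    ... | no a≢j | yes refl | _ = extra-at-3-via-j p a p≢io (≢-sym b≢p) a≢io a≢j (≢-sym a≢p) (∈C-swap₂₃ a b p y∈C)
    ... | no a≢j | no b≢j | yes refl = extra-at-3-via-j b a b≢io b≢j a≢io a≢j (≢-sym a≢b) y∈C
    ... | no a≢j | no b≢j | no p≢j = extra-at-3 a b p a≢io a≢j b≢io b≢j p≢io p≢j a≢b a≢p b≢p y∈C

    opaque
      extra-codeword : Σ (Word n) λ y → y ∈ Ir C 3 u × y ∉ flip io (flip j u) ∷ I-u-list
      extra-codeword = ⊈⇒∃∉ _≟W_ (Ir C 3 u) (flip io (flip j u) ∷ I-u-list) λ I₃⊆ →
        ℕₚ.≤⇒≯ (ℕₚ.≤-trans (⊆⇒length≤ _≟W_ (Ir C 3 u) _ (filterᵇ-unique _ (allWords-unique n)) I₃⊆)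
                           (ℕₚ.≤-reflexive (trans (cong suc length-I-u-list) (ℕₚ.m+[n∸m]≡n (ℕₚ.≤-trans (s≤s z≤n) n≥11)))))
               ∣I₃∣>n

    saves-at-2-orphan-side : ∀ k → k ≢ io → C (flip io (flip k u)) ≡ true → flip io (flip k u) ≢ flip io (flip j u) →
      SavesTwo
    saves-at-2-orphan-side k k≢io y∈C y≢d-j with k ≟F j
    ... | yes refl = ⊥-elim (y≢d-j refl)
    ... | no k≢j = extra-dominator k k≢io k≢j y∈C

    saves-at-2 : ∀ a b → a ≢ b → C (flip a (flip b u)) ≡ true → flip a (flip b u) ≢ flip io (flip j u) → SavesTwo
    saves-at-2 a b a≢b y∈C y≢d-j with a ≟F io | b ≟F io
    ... | yes refl | _ = saves-at-2-orphan-side b (≢-sym a≢b) y∈C y≢d-j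
    ... | no a≢io | yes refl =
      saves-at-2-orphan-side a a≢io (∈C-resp (flip-comm a b u) y∈C) (λ q → y≢d-j (trans (flip-comm a b u) q))
    ... | no a≢io | no b≢io with a ≟F j | b ≟F j
    ... | yes refl | _ = extra-at-2-via-j b b≢io (≢-sym a≢b) (∈C-resp (flip-comm a b u) y∈C)
    ... | no a≢j | yes refl = extra-at-2-via-j a a≢io a≢j y∈C
    ... | no a≢j | no b≢j = extra-at-2 a b a≢io a≢j b≢io b≢j a≢b y∈C

    saves-at-3 : ∀ a b p → a ≢ b → a ≢ p → b ≢ p → C (flip a (flip b (flip p u))) ≡ true → SavesTwo
    saves-at-3 a b p a≢b a≢p b≢p y∈C with a ≟F io | b ≟F io | p ≟F io
    ... | yes refl | _ | _ = extra-at-3-orphan-side-dispatch b p (≢-sym a≢b) (≢-sym a≢p) b≢p y∈C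
    ... | no a≢io | yes refl | _ = extra-at-3-orphan-side-dispatch a p a≢io (≢-sym b≢p) a≢p (∈C-swap₁₂ a b p y∈C)
    ... | no a≢io | no b≢io | yes refl =
      extra-at-3-orphan-side-dispatch a b a≢io b≢io a≢b (∈C-swap₁₂ a p b (∈C-swap₂₃ a b p y∈C))
    ... | no a≢io | no b≢io | no p≢io = extra-at-3-dispatch a b p a≢io b≢io p≢io a≢b a≢p b≢p y∈C

    savesTwo : SavesTwo
    savesTwo with extra-codeword
    ... | y , y∈I₃ , y∉ with ∧-true⁻ {C y} (proj₂ (∈-filterᵇ⁻ _ (allWords n) y∈I₃))
    ... | y∈C , y-close with within3 u y y-close
    ... | at0 refl = ⊥-elim (true≢false y∈C u∉C)
    ... | at1 a refl with a ≟F io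
    ...   | yes refl = ⊥-elim (true≢false y∈C flip-io-u∉C)
    ...   | no a≢io = ⊥-elim (y∉ (there (∈-map⁺ (λ k → flip k u) (∈-codirections a≢io))))
    savesTwo | y , y∈I₃ , y∉ | y∈C , _ | at2 a b a≢b refl = saves-at-2 a b a≢b y∈C (λ q → y∉ (here q))
    savesTwo | y , y∈I₃ , y∉ | y∈C , _ | at3 a b p a≢b a≢p b≢p refl = saves-at-3 a b p a≢b a≢p b≢p y∈C

  private
    Covered : Fin n → Set
    Covered a = a ≢ io → flip a u ∈ C′ C u

    covered? : ∀ a → Dec (Covered a)
    covered? a with a ≟F io | any? (flip a u ≟W_) (C′ C u)
    ... | yes a≡io | _ = yes (λ a≢io → ⊥-elim (a≢io a≡io))
    ... | no _ | yes c-a∈C′ = yes (λ _ → c-a∈C′)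
    ... | no a≢io | no c-a∉C′ = no (λ covered → c-a∉C′ (covered a≢io))

  1≤length-C′ : 1 ℕ.≤ length (C′ C u)
  1≤length-C′ = ⊆⇒length≤ _≟W_ (flip ic u ∷ []) (C′ C u) ([] ∷ []) (λ { (here refl) → flip-ic-u∈C′ })

  opaque
    unfolding SavesTwo
    average-C′≤bound : average C (C′ C u) ≤ bound n
    average-C′≤bound with all? covered?
    ... | yes all-covered =
      average≤bound n≥11 (length (C′ C u)) (sumMap (share C) (C′ C u)) 1≤length-C′ length-C′≤n∸1 (CaseII.savesTwo all-covered)
    ... | no not-all with ¬∀⟶∃¬ n Covered covered? not-all
    ... | a , not-covered = average≤ (length (C′ C u)) (sumMap (share C) (C′ C u)) (bound n) 1≤length-C′ (caseI a a≢io c-a∉C′)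
      where
        a≢io : a ≢ io
        a≢io a≡io = not-covered (λ a≢io → ⊥-elim (a≢io a≡io))
        c-a∉C′ : flip a u ∉ C′ C u
        c-a∉C′ c-a∈C′ = not-covered (λ _ → c-a∈C′)

rule1Share-of-∈C′ : ∀ {n} (C : Code n) {u c : Word n} → isSpecialFather C u ≡ true → c ∈ C′ C u →
  rule1Share C c ≡ average C (C′ C u)
rule1Share-of-∈C′ {n} C {u} {c} u-sf c∈C′
  with filterᵇ (λ w → isSpecialFather C w ∧ memW c (C′ C w)) (allWords n) in eq
... | [] with () ← subst (u ∈_) eq (∈-filterᵇ⁺ _ (allWords n) (∈-allWords u) (∧-true⁺ u-sf (∈⇒memW c (C′ C u) c∈C′)))
... | w ∷ _ = cong (λ z → average C (C′ C z)) (sym u≡w)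
  where
    open CodeFacts C
    w-listed : isSpecialFather C w ≡ true × memW c (C′ C w) ≡ true
    w-listed = ∧-true⁻ {isSpecialFather C w} (proj₂ (∈-filterᵇ⁻ _ (allWords n) (subst (w ∈_) (sym eq) (here refl))))
    c∈C′w : c ∈ C′ C w
    c∈C′w = memW⇒∈ c (C′ C w) (proj₂ w-listed)
    only-w : memW c (I C w) ≡ true × onlySF C w c ≡ true
    only-w = ∧-true⁻ {memW c (I C w)} (proj₂ (∈-filterᵇ⁻ _ (allWords n) c∈C′w))
    u∈N[c] : u ∈ Nclosed c
    u∈N[c] = ∈I⇒∈Nclosed (memW⇒∈ c (I C u) (proj₁ (∧-true⁻ {memW c (I C u)} (proj₂ (∈-filterᵇ⁻ _ (allWords n) c∈C′)))))
    u≡w : u ≡ w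
    u≡w with ∨-true⁻ (all⇒∀∈ (λ z → not (isSpecialFather C z) ∨ eqW z w) (Nclosed c)
                        (proj₁ (∧-true⁻ {all (λ z → not (isSpecialFather C z) ∨ eqW z w) (Nclosed c)} (proj₂ only-w))) u∈N[c])
    ... | inj₁ not-sf = ⊥-elim (true≢false u-sf (subst (λ b → b ≡ false) (not-involutive _) (cong not not-sf)))
    ... | inj₂ u≈w = eqW⇒≡ u w u≈w

lemma9 : (n : ℕ) → 11 ℕ.≤ n → (C : Code n) → LocatingDominating C
       → (u c : Word n) → isSpecialFather C u ≡ true
       → c ∈ I C u → isSpecial C c ≡ true
       → suc n ℕ.≤ length (Ir C 3 u)
       → Data.Rational._≤_ (rule1Share C c) (((+ n / 2) + 1ℚ) - inv (n ∸ 1))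
lemma9 n n≥11 C (_ , dominating , _) u c u-sf c∈I-u c-special ∣I₃∣>n =
  subst (_≤ bound n) (sym (rule1Share-of-∈C′ C u-sf c∈C′)) average-C′≤bound
  where open Setting n≥11 C u c u-sf c∈I-u c-special dominating ∣I₃∣>n using (c∈C′; average-C′≤bound)
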